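{- For every $i$ with $2\le i\le n$, if $\mathsf{lcp}_{01}[i]=\ell$, then for every $g\ge \ell+1$, at the end of iteration $g$ of the procedure described in the context it holds that $B[i]=\ell+1$.
   Context: Let $\Sigma$ be an alphabet of constant size $\sigma$, extended with two special symbols $\$_0<\$_1$ smaller than every symbol of $\Sigma$. Let $t_0[1,n_0]$ and $t_1[1,n_1]$ be strings with $t_0[n_0]=\$_0$ and $t_1[n_1]=\$_1$, these two symbols occurring nowhere else in either string. For a string $t[1,N]$, $t[i,j]$ denotes $t[i]\cdots t[j]$ (truncated at $N$; empty if $i>j$ or $i>N$); $\prec$ is lexicographic order. For $\delta\in\{0,1\}$: $sa_\delta$ is the suffix array of $t_\delta$; $\mathsf{bwt}_\delta[i]=t_\delta[sa_\delta[i]-1]$ if $sa_\delta[i]>1$ and $t_\delta[n_\delta]$ if $sa_\delta[i]=1$. Let $t_{01}=t_0t_1$, $n=n_0+n_1$, $sa_{01}$ its suffix array; $\mathsf{lcp}_{01}[i]$ for $2\le i\le n$ is the length of the longest common prefix of $t_{01}[sa_{01}[i-1],n]$ and $t_{01}[sa_{01}[i],n]$, and $\mathsf{lcp}_{01}[1]=\mathsf{lcp}_{01}[n+1]=-1$. Procedure. Given $\mathsf{bwt}_0,\mathsf{bwt}_1$, it maintains bit vectors $Z^{(h)}[1,n]$ and an integer array $B[1,n+1]$. Initially $Z^{(0)}=0^{n_0}1^{n_1}$ and $B=1\,0^{n-1}\,1$. Iteration $h\ge 1$: set $k_0=k_1=1$; for every symbol $c$ (including $\$_0,\$_1$) set $\mathsf{Block\_id}[c]=-1$;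 for every $c\in\Sigma$ set $F[c]=1+$ (number of occurrences in $\mathsf{bwt}_0$ and $\mathsf{bwt}_1$ of symbols smaller than $c$, counting $\$_0,\$_1$ as smaller). Then for $k=1,\ldots,n$: (1) if $B[k]\neq 0$ and $B[k]\neq h$, set $\mathsf{id}=k$; (2) let $b=Z^{(h-1)}[k]$, $c=\mathsf{bwt}_b[k_b]$, increment $k_b$; (3) if $c\in\Sigma$ set $j=F[c]$ and increment $F[c]$, else ($c=\$_b$) set $j=b+1$; (4) set $Z^{(h)}[j]=b$; (5) if $\mathsf{Block\_id}[c]\neq\mathsf{id}$, set $\mathsf{Block\_id}[c]=\mathsf{id}$ and, if $B[j]=0$, set $B[j]=h$. -}

module Defs where

open import Data.Nat using (ℕ; zero; suc; _+_; _∸_; _≤_; _<_; _<ᵇ_; _≡ᵇ_)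
open import Data.Bool using (Bool; true; false; if_then_else_; _∧_; not)
open import Data.List using (List; []; _∷_; length; drop; _++_)
open import Data.Maybe using (Maybe; just; nothing)
open import Data.Product using (_×_; _,_; proj₁; proj₂)
open import Relation.Binary.PropositionalEquality using (_≡_)
open import Data.List.Relation.Binary.Lex.Strict using (Lex-<)

-- Symbols and strings.
-- Symbols are natural numbers: $_0 is 0, $_1 is 1, and the alphabet
-- Σ of size σ is {2, …, σ+1}; so $_0 < $_1 < every symbol of Σ.

Sym : Set
Sym = ℕ

Str : Set
Str = List Sym

-- 1-indexed access t[k]  (returns 0 for out-of-range indices; never used there)
_!_ : Str → ℕ → Sym
[] ! k = 0
(x ∷ xs) ! zero = 0
(x ∷ xs) ! suc zero = x
(x ∷ xs) ! suc (suc k) = xs ! suc k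

suf : Str → ℕ → Str
suf t i = drop (i ∸ 1) t

-- lexicographic order ≺ (a proper prefix is smaller)
_≺_ : Str → Str → Set
_≺_ = Lex-< _≡_ _<_

-- t is a string over Σ (size σ) whose last symbol is $_δ (δ = 0 or 1),
-- occurring nowhere else (neither $_0 nor $_1 occurs elsewhere).
IsStr : ℕ → ℕ → Str → Set
IsStr δ σ t =
  (1 ≤ length t) × (t ! length t ≡ δ) ×
  (∀ k → 1 ≤ k → k < length t → (2 ≤ t ! k) × (t ! k < 2 + σ))

IsSA : Str → (ℕ → ℕ) → Set
IsSA t sa =
  (∀ i → 1 ≤ i → i ≤ length t → (1 ≤ sa i) × (sa i ≤ length t)) ×
  (∀ i j → 1 ≤ i → i ≤ length t → 1 ≤ j → j ≤ length t → sa i ≡ sa j → i ≡ j) ×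
  (∀ i → 1 ≤ i → i < length t → suf t (sa i) ≺ suf t (sa (suc i)))

bwt : Str → (ℕ → ℕ) → ℕ → Sym
bwt t sa i = if 1 <ᵇ sa i then t ! (sa i ∸ 1) else t ! length t

lcpLen : Str → Str → ℕ
lcpLen [] _ = 0
lcpLen (_ ∷ _) [] = 0
lcpLen (x ∷ xs) (y ∷ ys) = if x ≡ᵇ y then suc (lcpLen xs ys) else 0

lcp01 : Str → Str → (ℕ → ℕ) → ℕ → ℕ
lcp01 t0 t1 sa01 i =
  lcpLen (suf (t0 ++ t1) (sa01 (i ∸ 1))) (suf (t0 ++ t1) (sa01 i))

-- The procedure.  Arrays are functions ℕ → ℕ (1-indexed).

upd : {A : Set} → (ℕ → A) → ℕ → A → (ℕ → A)
upd f j v x = if x ≡ᵇ j then v else f x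

cntLess : (ℕ → Sym) → Sym → ℕ → ℕ
cntLess w c zero = 0
cntLess w c (suc m) = cntLess w c m + (if w (suc m) <ᵇ c then 1 else 0)

-- state during an iteration.
-- Block_id[c] = -1 is represented by nothing.
record St : Set where
  constructor st
  field
    k0 k1 : ℕ
    F     : ℕ → ℕ
    blk   : ℕ → Maybe ℕ
    ident : ℕ
    Znew  : ℕ → ℕ
    B     : ℕ → ℕ
open St public

eqM : Maybe ℕ → ℕ → Bool
eqM nothing _ = false
eqM (just a) b = a ≡ᵇ b

module Procedure (bwt0 bwt1 : ℕ → Sym) (n0 n1 : ℕ) where

  n : ℕ
  n = n0 + n1

  -- one step k of iteration h, with Zp = Z^(h-1)
  step : ℕ → (ℕ → ℕ) → St → ℕ → St
  step h Zp s k =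
    let id' = if not (B s k ≡ᵇ 0) ∧ not (B s k ≡ᵇ h) then k else ident s
        b   = Zp k
        isZ = b ≡ᵇ 0
        c   = if isZ then bwt0 (k0 s) else bwt1 (k1 s)
        k0' = if isZ then suc (k0 s) else k0 s
        k1' = if isZ then k1 s else suc (k1 s)
        inΣ = 1 <ᵇ c
        j   = if inΣ then F s c else suc b
        F'  = if inΣ then upd (F s) c (suc (F s c)) else F s
        Z'  = upd (Znew s) j b
        fresh = not (eqM (blk s c) id')
        blk' = if fresh then upd (blk s) c (just id') else blk s
        B'  = if fresh ∧ (B s j ≡ᵇ 0) then upd (B s) j h else B s
    in st k0' k1' F' blk' id' Z' B'

  steps : ℕ → (ℕ → ℕ) → St → ℕ → ℕ → St
  steps h Zp s from zero = s
  steps h Zp s from (suc m) = steps h Zp (step h Zp s from) (suc from) m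

  F₀ : ℕ → ℕ
  F₀ c = 1 + (cntLess bwt0 c n0 + cntLess bwt1 c n1)

  -- iteration h: input (Z^(h-1), B), output (Z^(h), B).
  -- The variable id is initialised to 0 (a value different from the
  -- initial Block_id value -1).
  iteration : ℕ → (ℕ → ℕ) × (ℕ → ℕ) → (ℕ → ℕ) × (ℕ → ℕ)
  iteration h (Zp , B₀) =
    let s = steps h Zp (st 1 1 F₀ (λ _ → nothing) 0 (λ _ → 0) B₀) 1 n
    in (Znew s , B s)

  Zinit : ℕ → ℕ
  Zinit k = if k <ᵇ suc n0 then 0 else 1

  Binit : ℕ → ℕ
  Binit k = if (k ≡ᵇ 1) Data.Bool.∨ (k ≡ᵇ suc n) then 1 else 0

  after : ℕ → (ℕ → ℕ) × (ℕ → ℕ)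
  after zero = (Zinit , Binit)
  after (suc g) = iteration (suc g) (after g)

  Bafter : ℕ → ℕ → ℕ
  Bafter g = proj₂ (after g)

Bat : Str → Str → (ℕ → ℕ) → (ℕ → ℕ) → ℕ → ℕ → ℕ
Bat t0 t1 sa0 sa1 g =
  Procedure.Bafter (bwt t0 sa0) (bwt t1 sa1) (length t0) (length t1) g

module Submission where

open import Defs
open import Data.Nat using (ℕ; _+_; _≤_)
open import Data.List using (length; _++_)
open import Relation.Binary.PropositionalEquality using (_≡_; refl)

-- Identify the n suffixes of t0 and t1 by merged indices
-- (TwoTexts) and sort them by their first h symbols, ties broken by index:
-- the h-order (PrefixOrder).  We show by induction on h that after
-- iteration h
--   (Z) Z^(h) lists the texts (colours) of the suffixes in the h-order, and
--   (B) B[i] = 1 for i = 1, B[i] = lcp_01[i] + 1 if i ≥ 2 and lcp_01[i] < h,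
--       and B[i] = 0 otherwise.
-- Iteration h+1 is an LF-mapping pass: the step at the position of
-- suffix x in the h-order reads bwt[x] and writes to the position of the
-- suffix c·x (with c = bwt[x]) in the (h+1)-order, which gives (Z).  The
-- step marks B there iff c·x is the first of its block of equal
-- (h+1)-prefixes, i.e. iff that position is a block boundary; by the
-- relation between t01 = t0 t1 and the merged suffixes (Concat), the
-- block boundaries i ≥ 2 are exactly the i with lcp_01[i] < h+1, which
-- gives (B).


module Booleans where

  open import Data.Nat using (zero; suc; _≤_; _<_; _<ᵇ_; _≡ᵇ_)
  open import Data.Nat.Properties using (≡ᵇ⇒≡; <ᵇ⇒<; <⇒<ᵇ; ≮⇒≥; <-irrefl)
  open import Data.Bool using (Bool; true; false; _∧_; not; T)
  open import Data.Empty using (⊥; ⊥-elim)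
  open import Data.Unit using (tt)
  open import Relation.Nullary using (¬_)
  open import Relation.Binary.PropositionalEquality

  t≢f : true ≡ false → ⊥
  t≢f ()

  b≡f : ∀ {b} → ¬ b ≡ true → b ≡ false
  b≡f {true} ne = ⊥-elim (ne refl)
  b≡f {false} ne = refl

  b≡t : ∀ {b} → ¬ b ≡ false → b ≡ true
  b≡t {true} ne = refl
  b≡t {false} ne = ⊥-elim (ne refl)

  ∧-true-left : ∀ {a b} → (a ∧ b) ≡ true → a ≡ true
  ∧-true-left {true} _ = refl

  ∧-true-right : ∀ {a b} → (a ∧ b) ≡ true → b ≡ true
  ∧-true-right {true} e = e

  eqb-true : ∀ {m n} → (m ≡ᵇ n) ≡ true → m ≡ n
  eqb-true {m} {n} e = ≡ᵇ⇒≡ m n (subst T (sym e) tt)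

  eqb-refl : ∀ n → (n ≡ᵇ n) ≡ true
  eqb-refl zero = refl
  eqb-refl (suc n) = eqb-refl n

  eqb-false : ∀ {m n} → ¬ m ≡ n → (m ≡ᵇ n) ≡ false
  eqb-false {m} {n} ne = b≡f (λ e → ne (eqb-true e))

  eqb-false⇒ : ∀ {m n} → (m ≡ᵇ n) ≡ false → ¬ m ≡ n
  eqb-false⇒ {m} e refl = t≢f (trans (sym (eqb-refl m)) e)

  ltb-true : ∀ {m n} → (m <ᵇ n) ≡ true → m < n
  ltb-true {m} {n} e = <ᵇ⇒< m n (subst T (sym e) tt)

  ltb-intro : ∀ {m n} → m < n → (m <ᵇ n) ≡ true
  ltb-intro {m} {n} lt with m <ᵇ n | <⇒<ᵇ lt
  ... | true | _ = refl

  ltb-false : ∀ {m n} → ¬ m < n → (m <ᵇ n) ≡ false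
  ltb-false ne = b≡f (λ e → ne (ltb-true e))

  ltb-false⇒ : ∀ {m n} → (m <ᵇ n) ≡ false → n ≤ m
  ltb-false⇒ e = ≮⇒≥ (λ lt → t≢f (trans (sym (ltb-intro lt)) e))

  lt-eq-exclusive : ∀ m n → ((m <ᵇ n) ∧ (m ≡ᵇ n)) ≡ false
  lt-eq-exclusive m n with m <ᵇ n in e
  ... | false = refl
  ... | true = eqb-false {m} {n} (λ q → <-irrefl q (ltb-true e))

  ∧-exclusive : ∀ (a b g : Bool) → (a ∧ b) ≡ false → (a ∧ (b ∧ g)) ≡ false
  ∧-exclusive true true g ()
  ∧-exclusive true false g _ = refl
  ∧-exclusive false b g _ = refl

module Counting where

  open import Data.Nat using (ℕ; zero; suc; _+_; _∸_; _≤_; _<_; _<ᵇ_; _≡ᵇ_; z≤n; s≤s)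
  open import Data.Nat.Properties
  open import Data.Bool using (Bool; true; false; if_then_else_; _∧_; _∨_; not)
  open import Data.Bool.Properties using (∧-identityʳ)
  open import Data.Product using (Σ; _×_; _,_; proj₁; proj₂)
  open import Data.Sum using (_⊎_; inj₁; inj₂)
  open import Data.Empty using (⊥; ⊥-elim)
  open import Relation.Nullary using (¬_)
  open import Relation.Binary.PropositionalEquality
  open Booleans

  cnt : (ℕ → Bool) → ℕ → ℕ
  cnt P zero = 0
  cnt P (suc N) = cnt P N + (if P (suc N) then 1 else 0)

  In : ℕ → ℕ → Set
  In N x = (1 ≤ x) × (x ≤ N)

  In-suc : ∀ {N x} → In N x → In (suc N) x
  In-suc (a , b) = a , m≤n⇒m≤1+n b

  In-top : ∀ N → In (suc N) (suc N)
  In-top N = s≤s z≤n , ≤-refl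

  In-zero : ∀ {x} → ¬ In 0 x
  In-zero (a , b) = 1+n≰n (≤-trans a b)

  In-suc-cases : ∀ {N x} → In (suc N) x → In N x ⊎ x ≡ suc N
  In-suc-cases (a , b) with m≤n⇒m<n∨m≡n b
  ... | inj₁ lt = inj₁ (a , ≤-pred lt)
  ... | inj₂ eq = inj₂ eq

  suc-∸1 : ∀ x → 1 ≤ x → suc (x ∸ 1) ≡ x
  suc-∸1 (suc x) _ = refl

  cnt-ext : ∀ P Q N → (∀ x → In N x → P x ≡ Q x) → cnt P N ≡ cnt Q N
  cnt-ext P Q zero h = refl
  cnt-ext P Q (suc N) h rewrite cnt-ext P Q N (λ x i → h x (In-suc i)) | h (suc N) (In-top N) = refl

  bit-mono : ∀ a b → (a ≡ true → b ≡ true) → (if a then 1 else 0) ≤ (if b then 1 else 0)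
  bit-mono true b h rewrite h refl = ≤-refl
  bit-mono false b h = z≤n

  cnt-mono : ∀ P Q N → (∀ x → In N x → P x ≡ true → Q x ≡ true) → cnt P N ≤ cnt Q N
  cnt-mono P Q zero h = z≤n
  cnt-mono P Q (suc N) h =
    +-mono-≤ (cnt-mono P Q N (λ x i → h x (In-suc i))) (bit-mono (P (suc N)) (Q (suc N)) (h (suc N) (In-top N)))

  cnt-strict : ∀ P Q N → (∀ x → In N x → P x ≡ true → Q x ≡ true) →
    ∀ y → In N y → P y ≡ false → Q y ≡ true → suc (cnt P N) ≤ cnt Q N
  cnt-strict P Q zero h y iy py qy = ⊥-elim (In-zero iy)
  cnt-strict P Q (suc N) h y iy py qy with In-suc-cases iy
  ... | inj₁ iy' = ≤-trans (s≤s ≤-refl)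
        (+-mono-≤ (cnt-strict P Q N (λ x i → h x (In-suc i)) y iy' py qy) (bit-mono (P (suc N)) (Q (suc N)) (h (suc N) (In-top N))))
  ... | inj₂ refl rewrite py | qy | +-identityʳ (cnt P N) =
        subst (_≤ cnt Q N + 1) (+-comm (cnt P N) 1) (+-monoˡ-≤ 1 (cnt-mono P Q N (λ x i → h x (In-suc i))))

  cnt-true : ∀ N → cnt (λ _ → true) N ≡ N
  cnt-true zero = refl
  cnt-true (suc N) rewrite cnt-true N = +-comm N 1

  cnt-false : ∀ P N → (∀ x → In N x → P x ≡ false) → cnt P N ≡ 0
  cnt-false P zero h = refl
  cnt-false P (suc N) h rewrite h (suc N) (In-top N) = trans (+-identityʳ _) (cnt-false P N (λ x i → h x (In-suc i)))

  cnt-pos : ∀ P N x → In N x → P x ≡ true → 1 ≤ cnt P N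
  cnt-pos P N x ix px = subst (λ u → suc u ≤ cnt P N) (cnt-false (λ _ → false) N (λ _ _ → refl))
    (cnt-strict (λ _ → false) P N (λ _ _ ()) x ix refl px)

  swap-middle : ∀ a b c d → a + b + (c + d) ≡ a + c + (b + d)
  swap-middle a b c d = trans (+-assoc a b (c + d)) (trans (cong (a +_) (trans (sym (+-assoc b c d))
    (trans (cong (_+ d) (+-comm b c)) (+-assoc c b d)))) (sym (+-assoc a c (b + d))))

  cnt-compl : ∀ P N → cnt P N + cnt (λ x → not (P x)) N ≡ N
  cnt-compl P zero = refl
  cnt-compl P (suc N) = trans (swap-middle (cnt P N) _ (cnt (λ x → not (P x)) N) _)
    (trans (cong₂ _+_ (cnt-compl P N) (bits (P (suc N)))) (+-comm N 1))
    where bits : ∀ b → (if b then 1 else 0) + (if not b then 1 else 0) ≡ 1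
          bits true = refl
          bits false = refl

  bit-or : ∀ a b → (a ∧ b) ≡ false → (if a ∨ b then 1 else 0) ≡ (if a then 1 else 0) + (if b then 1 else 0)
  bit-or true false _ = refl
  bit-or false b _ = refl

  cnt-or : ∀ P Q N → (∀ x → In N x → (P x ∧ Q x) ≡ false) → cnt (λ x → P x ∨ Q x) N ≡ cnt P N + cnt Q N
  cnt-or P Q zero h = refl
  cnt-or P Q (suc N) h rewrite cnt-or P Q N (λ x i → h x (In-suc i)) | bit-or (P (suc N)) (Q (suc N)) (h (suc N) (In-top N)) =
    swap-middle (cnt P N) (cnt Q N) (if P (suc N) then 1 else 0) (if Q (suc N) then 1 else 0)

  cnt-remove : ∀ Q M y → In M y → Q y ≡ true → cnt Q M ≡ suc (cnt (λ z → Q z ∧ not (z ≡ᵇ y)) M)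
  cnt-remove Q zero y iy qy = ⊥-elim (In-zero iy)
  cnt-remove Q (suc M) y iy qy with In-suc-cases iy
  ... | inj₁ iy' rewrite cnt-remove Q M y iy' qy | eqb-false {suc M} {y} (λ e → 1+n≰n (subst (_≤ M) (sym e) (proj₂ iy'))) with Q (suc M)
  ...   | true = refl
  ...   | false = refl
  cnt-remove Q (suc M) y iy qy | inj₂ refl rewrite qy | eqb-refl (suc M) =
    trans (+-comm (cnt Q M) 1) (cong suc (trans (cnt-ext Q _ M below) (sym (+-identityʳ _))))
    where below : ∀ x → In M x → Q x ≡ (Q x ∧ not (x ≡ᵇ suc M))
          below x (_ , d) = sym (trans (cong (λ u → Q x ∧ not u) (eqb-false {x} {suc M} (λ e → 1+n≰n (subst (_≤ M) e d))))
                                       (∧-identityʳ (Q x)))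

  cnt-inj : ∀ P Q (f : ℕ → ℕ) N M →
    (∀ x → In N x → P x ≡ true → In M (f x) × Q (f x) ≡ true) →
    (∀ x y → In N x → In N y → P x ≡ true → P y ≡ true → f x ≡ f y → x ≡ y) →
    cnt P N ≤ cnt Q M
  cnt-inj P Q f zero M h inj = z≤n
  cnt-inj P Q f (suc N) M h inj with P (suc N) in e
  ... | false = subst (_≤ cnt Q M) (sym (+-identityʳ _)) (cnt-inj P Q f N M (λ x i → h x (In-suc i)) (λ x y i j → inj x y (In-suc i) (In-suc j)))
  ... | true = subst (_≤ cnt Q M) (+-comm 1 (cnt P N))
                 (subst (suc (cnt P N) ≤_) (sym (cnt-remove Q M (f (suc N)) (proj₁ top) (proj₂ top))) (s≤s rest))
    where
    top = h (suc N) (In-top N) e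
    -- the remaining P-points avoid the image f (N+1) of the top point
    rest : cnt P N ≤ cnt (λ z → Q z ∧ not (z ≡ᵇ f (suc N))) M
    rest = cnt-inj P (λ z → Q z ∧ not (z ≡ᵇ f (suc N))) f N M
      (λ x i px → proj₁ (h x (In-suc i) px) ,
         subst (λ u → (u ∧ not (f x ≡ᵇ f (suc N))) ≡ true) (sym (proj₂ (h x (In-suc i) px)))
           (cong not (eqb-false (λ fe → 1+n≰n (subst (_≤ N) (inj x (suc N) (In-suc i) (In-top N) px e fe) (proj₂ i))))))
      (λ x y i j → inj x y (In-suc i) (In-suc j))

  search : ∀ (P : ℕ → Bool) N → (Σ ℕ λ x → In N x × P x ≡ true) ⊎ (∀ x → In N x → P x ≡ false)
  search P zero = inj₂ (λ x i → ⊥-elim (In-zero i))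
  search P (suc N) with search P N
  ... | inj₁ (x , i , p) = inj₁ (x , In-suc i , p)
  ... | inj₂ none with P (suc N) in e
  ...   | true = inj₁ (suc N , In-top N , e)
  ...   | false = inj₂ λ x i → case (In-suc-cases i)
    where case : ∀ {x} → In N x ⊎ x ≡ suc N → P x ≡ false
          case (inj₁ i) = none _ i
          case (inj₂ refl) = e

  cnt-witness : ∀ P N → 1 ≤ cnt P N → Σ ℕ λ x → In N x × P x ≡ true
  cnt-witness P N pos with search P N
  ... | inj₁ w = w
  ... | inj₂ none = ⊥-elim (1+n≰n (subst (1 ≤_) (cnt-false P N none) pos))

  Perm : (ℕ → ℕ) → ℕ → Set
  Perm π N = (∀ x → In N x → In N (π x)) × (∀ x y → In N x → In N y → π x ≡ π y → x ≡ y)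

  cnt-perm : ∀ P π N → Perm π N → cnt (λ x → P (π x)) N ≡ cnt P N
  cnt-perm P π N (into , inj) = ≤-antisym le ge
    where
    le : cnt (λ x → P (π x)) N ≤ cnt P N
    le = cnt-inj _ P π N N (λ x i p → into x i , p) (λ x y i j _ _ → inj x y i j)
    le-not : cnt (λ x → not (P (π x))) N ≤ cnt (λ x → not (P x)) N
    le-not = cnt-inj _ _ π N N (λ x i p → into x i , p) (λ x y i j _ _ → inj x y i j)
    ge : cnt P N ≤ cnt (λ x → P (π x)) N
    ge = +-cancelʳ-≤ (cnt (λ x → not (P (π x))) N) _ _
           (subst₂ _≤_ refl (sym (cnt-compl (λ x → P (π x)) N))
             (subst (cnt P N + cnt (λ x → not (P (π x))) N ≤_) (cnt-compl P N) (+-monoʳ-≤ (cnt P N) le-not)))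

  surj : ∀ π N → Perm π N → ∀ y → In N y → Σ ℕ λ x → In N x × π x ≡ y
  surj π N (into , inj) y iy with search (λ x → π x ≡ᵇ y) N
  ... | inj₁ (x , i , e) = x , i , eqb-true e
  ... | inj₂ none = ⊥-elim (1+n≰n (subst (_≤ cnt Q N) (cnt-remove (λ _ → true) N y iy refl) c))
    where
    Q = λ z → true ∧ not (z ≡ᵇ y)
    c : cnt (λ _ → true) N ≤ cnt Q N
    c = cnt-inj (λ _ → true) Q π N N (λ x i _ → into x i , cong not (none x i)) (λ x y' i j _ _ → inj x y' i j)

  -- The largest x ∈ [1, N] with P x (0 if none); used to invert permutations.
  findLast : (ℕ → Bool) → ℕ → ℕ
  findLast P zero = 0
  findLast P (suc N) = if P (suc N) then suc N else findLast P N

  findLast-spec : ∀ P N → (Σ ℕ λ x → In N x × P x ≡ true) → In N (findLast P N) × P (findLast P N) ≡ true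
  findLast-spec P zero (x , i , _) = ⊥-elim (In-zero i)
  findLast-spec P (suc N) (x , i , px) with P (suc N) in e
  ... | true = In-top N , e
  ... | false with In-suc-cases i
  ...   | inj₁ i' = In-suc (proj₁ r) , proj₂ r
    where r = findLast-spec P N (x , i' , px)
  ...   | inj₂ refl = ⊥-elim (t≢f (trans (sym px) e))

  inverse : (ℕ → ℕ) → ℕ → ℕ → ℕ
  inverse π N y = findLast (λ x → π x ≡ᵇ y) N

  inverse-spec : ∀ π N → Perm π N → ∀ y → In N y → In N (inverse π N y) × π (inverse π N y) ≡ y
  inverse-spec π N perm y iy =
    let (x , ix , e) = surj π N perm y iy
        r = findLast-spec (λ x → π x ≡ᵇ y) N (x , ix , subst (λ u → (u ≡ᵇ y) ≡ true) (sym e) (eqb-refl y))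
    in proj₁ r , eqb-true (proj₂ r)

  cnt-one : ∀ P N y → In N y → P y ≡ true → (∀ x → In N x → P x ≡ true → x ≡ y) → cnt P N ≡ 1
  cnt-one P N y iy py h = trans (cnt-remove P N y iy py) (cong suc (cnt-false _ N λ x ix → b≡f (λ e → other x ix e)))
    where
    other : ∀ x → In N x → (P x ∧ not (x ≡ᵇ y)) ≡ true → ⊥
    other x ix e = eqb-false⇒ (b≡f (λ q → t≢f (trans (sym (∧-true-right e)) (cong not q)))) (h x ix (∧-true-left e))

  cnt-split : ∀ P a b → cnt P (a + b) ≡ cnt P a + cnt (λ i → P (a + i)) b
  cnt-split P a zero = trans (cong (cnt P) (+-identityʳ a)) (sym (+-identityʳ _))
  cnt-split P a (suc b) rewrite +-suc a b | cnt-split P a b = +-assoc (cnt P a) _ _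

  cnt-below : ∀ k N → k ≤ suc N → cnt (λ x → x <ᵇ k) N ≡ k ∸ 1
  cnt-below k zero le with k
  ... | zero = refl
  ... | suc zero = refl
  ... | suc (suc _) with le
  ...   | s≤s ()
  cnt-below k (suc N) le with m≤n⇒m<n∨m≡n le
  ... | inj₁ lt rewrite cnt-below k N (≤-pred lt) | ltb-false {suc N} {k} (λ l → 1+n≰n (≤-trans l (≤-pred lt))) = +-identityʳ _
  ... | inj₂ refl = all-below (suc N) ≤-refl
    where all-below : ∀ M → M < suc (suc N) → cnt (λ x → x <ᵇ suc (suc N)) M ≡ M
          all-below zero lt = refl
          all-below (suc M) lt rewrite all-below M (≤-trans (n≤1+n _) lt) | ltb-intro lt = +-comm M 1

  cnt-tail : ∀ Q m N → m ≤ N → (∀ j → m < j → j ≤ N → Q j ≡ false) → cnt Q N ≡ cnt Q m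
  cnt-tail Q m zero le h rewrite n≤0⇒n≡0 le = refl
  cnt-tail Q m (suc N) le h with m≤n⇒m<n∨m≡n le
  ... | inj₂ refl = refl
  ... | inj₁ l rewrite h (suc N) l ≤-refl = trans (+-identityʳ _) (cnt-tail Q m N (≤-pred l) (λ j a b → h j a (≤-trans b (n≤1+n N))))

  cnt-prefix : ∀ P m N → m ≤ N → cnt P m ≡ cnt (λ j → (j <ᵇ suc m) ∧ P j) N
  cnt-prefix P m N le = trans (cnt-ext P _ m (λ j (a , b) → cong (_∧ P j) (sym (ltb-intro (s≤s b)))))
    (sym (cnt-tail _ m N le (λ j a b → cong (_∧ P j) (ltb-false (λ l → 1+n≰n (≤-trans a (≤-pred l)))))))

  downclosed-count : ∀ P N → (∀ j j' → 1 ≤ j' → j' ≤ j → j ≤ N → P j ≡ true → P j' ≡ true) →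
    ∀ m → 1 ≤ m → m < N → cnt P N ≡ m → P m ≡ true × P (suc m) ≡ false
  downclosed-count P N dc m m1 mN e = holds , fails
    where
    holds : P m ≡ true
    holds = b≡t λ pf → pred-absurd m m1 (subst (_≤ m ∸ 1) e (subst (cnt P N ≤_) (cnt-below m N (≤-trans (<⇒≤ mN) (n≤1+n N)))
             (cnt-mono P (λ j → j <ᵇ m) N (λ j (a , b) pj → ltb-intro (≰⇒> (λ mj → t≢f (trans (sym (dc j m m1 mj b pj)) pf)))))))
      where pred-absurd : ∀ m → 1 ≤ m → m ≤ m ∸ 1 → ⊥
            pred-absurd (suc k) _ le = 1+n≰n le
    fails : P (suc m) ≡ false
    fails = b≡f λ pt → 1+n≰n (subst (suc m ≤_) e (subst (_≤ cnt P N) (cnt-below (suc (suc m)) N (s≤s mN))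
             (cnt-mono (λ j → j <ᵇ suc (suc m)) P N (λ j (a , b) lt → dc (suc m) j a (≤-pred (ltb-true lt)) mN pt))))

module Lex where

  open import Data.Nat using (ℕ; zero; suc; _≤_; _<_; _<ᵇ_; _≡ᵇ_; _≟_)
  open import Data.Nat.Properties using (<-irrefl; <-trans; <-cmp; ≤-trans; ≤-pred; 1+n≰n)
  open import Data.Bool using (Bool; true; false; if_then_else_; _∧_; _∨_)
  open import Data.List using ([]; _∷_; take; _++_)
  open import Data.List.Relation.Unary.All using (All; []; _∷_)
  open import Data.List.Relation.Binary.Lex.Core using (halt; this; next)
  open import Data.List.Relation.Binary.Lex.Strict using (<-irreflexive; <-transitive; <-compare)
  open import Data.List.Relation.Binary.Pointwise using (≡⇒Pointwise-≡; Pointwise-≡⇒≡)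
  open import Data.Product using (Σ; _×_; _,_)
  open import Data.Sum using (_⊎_; inj₁; inj₂)
  open import Data.Empty using (⊥-elim)
  open import Relation.Nullary using (¬_; yes; no)
  open import Relation.Binary.Definitions using (tri<; tri≈; tri>)
  open import Relation.Binary.PropositionalEquality
  open import Relation.Binary.PropositionalEquality.Properties using (isEquivalence)
  open import Defs
  open Booleans

  lex-irrefl : ∀ {s} → ¬ (s ≺ s)
  lex-irrefl = <-irreflexive (λ e → <-irrefl e) (≡⇒Pointwise-≡ refl)

  lex-trans : ∀ {a b c} → a ≺ b → b ≺ c → a ≺ c
  lex-trans = <-transitive isEquivalence (resp₂ _<_) <-trans

  lex-asym : ∀ {a b} → a ≺ b → ¬ (b ≺ a)
  lex-asym p q = lex-irrefl (lex-trans p q)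

  data Tri3 (a b : Str) : Set where
    tlt : a ≺ b → Tri3 a b
    teq : a ≡ b → Tri3 a b
    tgt : b ≺ a → Tri3 a b

  lex-cmp : ∀ a b → Tri3 a b
  lex-cmp a b with <-compare sym <-cmp a b
  ... | tri< p _ _ = tlt p
  ... | tri≈ _ e _ = teq (Pointwise-≡⇒≡ e)
  ... | tri> _ _ p = tgt p

  lex-cons : ∀ {c a b} → (c ∷ a) ≺ (c ∷ b) → a ≺ b
  lex-cons (this p) = ⊥-elim (<-irrefl refl p)
  lex-cons (next _ p) = p

  ltL : Str → Str → Bool
  ltL [] [] = false
  ltL [] (_ ∷ _) = true
  ltL (_ ∷ _) [] = false
  ltL (x ∷ a) (y ∷ b) = if x <ᵇ y then true else (if x ≡ᵇ y then ltL a b else false)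

  ltL-sound : ∀ a b → ltL a b ≡ true → a ≺ b
  ltL-sound [] (y ∷ b) _ = halt
  ltL-sound (x ∷ a) (y ∷ b) e with x <ᵇ y in e1
  ... | true = this (ltb-true e1)
  ... | false with x ≡ᵇ y in e2
  ...   | true = next (eqb-true e2) (ltL-sound a b e)

  ltL-complete : ∀ {a b} → a ≺ b → ltL a b ≡ true
  ltL-complete halt = refl
  ltL-complete (this p) rewrite ltb-intro p = refl
  ltL-complete (next {x} refl p) rewrite ltb-false (<-irrefl {x} {x} refl) | eqb-refl x = ltL-complete p

  ltL-false : ∀ a b → ¬ a ≺ b → ltL a b ≡ false
  ltL-false a b ne = b≡f (λ e → ne (ltL-sound a b e))

  eqL : Str → Str → Bool
  eqL [] [] = true
  eqL [] (_ ∷ _) = false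
  eqL (_ ∷ _) [] = false
  eqL (x ∷ a) (y ∷ b) = (x ≡ᵇ y) ∧ eqL a b

  eqL-sound : ∀ a b → eqL a b ≡ true → a ≡ b
  eqL-sound [] [] _ = refl
  eqL-sound (x ∷ a) (y ∷ b) e = cong₂ _∷_ (eqb-true (∧-true-left e)) (eqL-sound a b (∧-true-right e))

  eqL-refl : ∀ a → eqL a a ≡ true
  eqL-refl [] = refl
  eqL-refl (x ∷ a) rewrite eqb-refl x = eqL-refl a

  eqL-false : ∀ a b → ¬ a ≡ b → eqL a b ≡ false
  eqL-false a b ne = b≡f (λ e → ne (eqL-sound a b e))

  eqL-false⇒ : ∀ a b → eqL a b ≡ false → ¬ a ≡ b
  eqL-false⇒ a .a e refl = t≢f (trans (sym (eqL-refl a)) e)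

  take-mono : ∀ h {a b} → a ≺ b → take h a ≺ take h b ⊎ take h a ≡ take h b
  take-mono zero p = inj₂ refl
  take-mono (suc h) halt = inj₁ halt
  take-mono (suc h) (this p) = inj₁ (this p)
  take-mono (suc h) (next refl p) with take-mono h p
  ... | inj₁ q = inj₁ (next refl q)
  ... | inj₂ q = inj₂ (cong (_ ∷_) q)

  -- Div a b: a and b differ at a position that exists in both (neither
  -- is a prefix of the other).
  data Div : Str → Str → Set where
    dhere : ∀ {x y a b} → ¬ x ≡ y → Div (x ∷ a) (y ∷ b)
    dnext : ∀ {x a b} → Div a b → Div (x ∷ a) (x ∷ b)

  div-sym : ∀ {a b} → Div a b → Div b a
  div-sym (dhere ne) = dhere (λ e → ne (sym e))
  div-sym (dnext d) = dnext (div-sym d)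

  div-neq : ∀ {a b} → Div a b → ¬ a ≡ b
  div-neq (dhere ne) refl = ne refl
  div-neq (dnext d) refl = div-neq d refl

  div-cmp : ∀ {a b} → Div a b → a ≺ b ⊎ b ≺ a
  div-cmp {a} {b} d with lex-cmp a b
  ... | tlt p = inj₁ p
  ... | teq e = ⊥-elim (div-neq d e)
  ... | tgt p = inj₂ p

  div-app : ∀ {a b} u v → Div a b → Div (a ++ u) (b ++ v)
  div-app u v (dhere ne) = dhere ne
  div-app u v (dnext d) = dnext (div-app u v d)

  div-lcp : ∀ {a b} u v → Div a b → lcpLen (a ++ u) (b ++ v) ≡ lcpLen a b
  div-lcp u v (dhere ne) rewrite eqb-false ne = refl
  div-lcp {x ∷ _} u v (dnext d) rewrite eqb-refl x = cong suc (div-lcp u v d)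

  div-lex : ∀ {a b} u v → Div a b → a ≺ b → (a ++ u) ≺ (b ++ v)
  div-lex u v (dhere ne) (this p) = this p
  div-lex u v (dhere ne) (next e p) = ⊥-elim (ne e)
  div-lex u v (dnext d) (this p) = this p
  div-lex u v (dnext d) (next e p) = next e (div-lex u v d p)

  div-lex⇒ : ∀ {a b} u v → Div a b → (a ++ u) ≺ (b ++ v) → a ≺ b
  div-lex⇒ u v d p with div-cmp d
  ... | inj₁ q = q
  ... | inj₂ q = ⊥-elim (lex-asym p (div-lex v u (div-sym d) q))

  div-take-eq : ∀ {a b} h → Div a b → h ≤ lcpLen a b → take h a ≡ take h b
  div-take-eq zero d le = refl
  div-take-eq (suc h) (dhere ne) le rewrite eqb-false ne with le
  ... | ()
  div-take-eq {x ∷ _} (suc h) (dnext d) le rewrite eqb-refl x = cong (x ∷_) (div-take-eq h d (≤-pred le))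

  div-take-lt : ∀ {a b} h → Div a b → lcpLen a b < h → a ≺ b → take h a ≺ take h b
  div-take-lt (suc h) (dhere ne) le (this p) = this p
  div-take-lt (suc h) (dhere ne) le (next e p) = ⊥-elim (ne e)
  div-take-lt (suc h) (dnext d) le (this p) = this p
  div-take-lt {x ∷ _} (suc h) (dnext d) le (next e p) rewrite eqb-refl x = next e (div-take-lt h d (≤-pred le) p)

  Ends : Str → Set
  Ends a = Σ Str λ a' → Σ ℕ λ d → (a ≡ a' ++ (d ∷ [])) × (d ≤ 1) × All (2 ≤_) a'

  -- Distinct terminated strings diverge (the terminator is unmatched).
  ends-div : ∀ {a b} → Ends a → Ends b → ¬ a ≡ b → Div a b
  ends-div (a' , d , refl , d1 , pa) (b' , d' , refl , d1' , pb) ne = go a' b' pa pb ne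
    where
    go : ∀ a' b' → All (2 ≤_) a' → All (2 ≤_) b' → ¬ (a' ++ (d ∷ [])) ≡ (b' ++ (d' ∷ [])) → Div (a' ++ (d ∷ [])) (b' ++ (d' ∷ []))
    go [] [] _ _ ne = dhere (λ e → ne (cong (_∷ []) e))
    go [] (y ∷ b') _ (py ∷ _) ne = dhere (λ e → 1+n≰n (≤-trans py (subst (_≤ 1) e d1)))
    go (x ∷ a') [] (px ∷ _) _ ne = dhere (λ e → 1+n≰n (≤-trans px (subst (_≤ 1) (sym e) d1')))
    go (x ∷ a') (y ∷ b') (px ∷ pa) (py ∷ pb) ne with x ≟ y
    ... | no xy = dhere xy
    ... | yes refl = dnext (go a' b' pa pb (λ e → ne (cong (x ∷_) e)))

  ends-nonempty : ∀ {a} → Ends a → Σ ℕ λ x → Σ Str λ r → a ≡ x ∷ r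
  ends-nonempty ([] , d , refl , _) = d , [] , refl
  ends-nonempty (x ∷ a' , d , refl , _) = x , a' ++ (d ∷ []) , refl

  ends-head≤1 : ∀ {x r} → Ends (x ∷ r) → x ≤ 1 → r ≡ []
  ends-head≤1 ([] , d , refl , _) _ = refl
  ends-head≤1 (y ∷ a' , d , refl , _ , py ∷ _) x1 = ⊥-elim (1+n≰n (≤-trans py x1))

  cons-split : ∀ (p q : Str) d c a b (i j : ℕ) → p ≡ d ∷ a → q ≡ c ∷ b →
    (ltL p q ∨ (eqL p q ∧ (i <ᵇ j))) ≡ ((d <ᵇ c) ∨ ((d ≡ᵇ c) ∧ (ltL p q ∨ (eqL p q ∧ (i <ᵇ j)))))
  cons-split .(d ∷ a) .(c ∷ b) d c a b i j refl refl with d <ᵇ c | d ≡ᵇ c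
  ... | true | _ = refl
  ... | false | true = refl
  ... | false | false = refl

  cons-same : ∀ (p q : Str) c a b (g : Bool) → p ≡ c ∷ a → q ≡ c ∷ b →
    (ltL p q ∨ (eqL p q ∧ g)) ≡ (ltL a b ∨ (eqL a b ∧ g))
  cons-same .(c ∷ a) .(c ∷ b) c a b g refl refl rewrite ltb-false {c} {c} (<-irrefl refl) | eqb-refl c = refl

module OneText where

  open import Data.Nat using (ℕ; zero; suc; _+_; _∸_; _≤_; _<_; _<ᵇ_; z≤n; s≤s)
  open import Data.Nat.Properties
  open import Data.Bool using (true; false; if_then_else_)
  open import Data.List using ([]; _∷_; length; drop; take; _++_)
  open import Data.List.Properties using (length-++; length-drop; drop-all)
  open import Data.List.Relation.Unary.All using (All; []; _∷_)
  open import Data.List.Relation.Unary.All.Properties using (drop⁺)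
  open import Data.Product using (Σ; _×_; _,_; proj₁; proj₂)
  open import Data.Sum using (_⊎_; inj₁; inj₂)
  open import Data.Empty using (⊥-elim)
  open import Relation.Binary.PropositionalEquality
  open import Defs
  open Counting
  open Lex

  -- First symbol of a string (0 for the empty string).
  hd : Str → ℕ
  hd [] = 0
  hd (x ∷ _) = x

  hd-eq : ∀ {s d r} → s ≡ d ∷ r → hd s ≡ d
  hd-eq refl = refl

  hd-take : ∀ m s → hd (take (suc m) s) ≡ hd s
  hd-take m [] = refl
  hd-take m (a ∷ s) = refl

  decomp : ∀ δ t → 1 ≤ length t → (∀ k → 1 ≤ k → k < length t → 2 ≤ t ! k) → t ! length t ≡ δ →
    Σ Str λ t' → (t ≡ t' ++ (δ ∷ [])) × All (2 ≤_) t'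
  decomp δ (x ∷ []) _ h e = [] , cong (_∷ []) e , []
  decomp δ (x ∷ y ∷ ys) _ h e with decomp δ (y ∷ ys) (s≤s z≤n) (λ { (suc k) _ lt → h (suc (suc k)) (s≤s z≤n) (s≤s lt) }) e
  ... | t' , eq , a = x ∷ t' , cong (x ∷_) eq , h 1 ≤-refl (s≤s (s≤s z≤n)) ∷ a

  drop-app : ∀ k (a b : Str) → k ≤ length a → drop k (a ++ b) ≡ drop k a ++ b
  drop-app zero a b _ = refl
  drop-app (suc k) (x ∷ a) b (s≤s le) = drop-app k a b le

  drop-app2 : ∀ k (a b : Str) → drop (length a + k) (a ++ b) ≡ drop k b
  drop-app2 k [] b = refl
  drop-app2 k (x ∷ a) b = drop-app2 k a b

  drop-! : ∀ t p → 1 ≤ p → p ≤ length t → drop (p ∸ 1) t ≡ (t ! p) ∷ drop p t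
  drop-! (x ∷ t) (suc zero) _ _ = refl
  drop-! (x ∷ t) (suc (suc k)) _ (s≤s b) = drop-! t (suc k) (s≤s z≤n) b

  module Text (δ σ : ℕ) (t : Str) (sa : ℕ → ℕ) (d≤1 : δ ≤ 1) (hs : IsStr δ σ t) (ha : IsSA t sa) where

    N : ℕ
    N = length t

    1≤N : 1 ≤ N
    1≤N = proj₁ hs

    chr-last : t ! N ≡ δ
    chr-last = proj₁ (proj₂ hs)

    chr-mid : ∀ k → 1 ≤ k → k < N → 2 ≤ t ! k
    chr-mid k a b = proj₁ (proj₂ (proj₂ hs) k a b)

    dec : Σ Str λ t' → (t ≡ t' ++ (δ ∷ [])) × All (2 ≤_) t'
    dec = decomp δ t 1≤N chr-mid chr-last

    t' : Str
    t' = proj₁ dec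

    lenN : N ≡ length t' + 1
    lenN = trans (cong length (proj₁ (proj₂ dec))) (length-++ t')

    suf-ends : ∀ p → In N p → Σ Str λ a → (suf t p ≡ a ++ (δ ∷ [])) × All (2 ≤_) a
    suf-ends p (a , b) = drop (p ∸ 1) t' ,
        trans (cong (drop (p ∸ 1)) (proj₁ (proj₂ dec))) (drop-app (p ∸ 1) t' _ le) ,
        drop⁺ (p ∸ 1) (proj₂ (proj₂ dec))
      where le : p ∸ 1 ≤ length t'
            le = subst (p ∸ 1 ≤_) (m+n∸n≡m (length t') 1) (∸-monoˡ-≤ 1 (subst (p ≤_) lenN b))

    suf-cons : ∀ p → In N p → suf t p ≡ (t ! p) ∷ suf t (suc p)
    suf-cons p (a , b) = drop-! t p a b

    -- Distinct positions have distinct suffixes (their lengths differ).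
    suf-inj : ∀ p q → In N p → In N q → suf t p ≡ suf t q → p ≡ q
    suf-inj p q (a , b) (c , d) e =
      let lengths : N ∸ (p ∸ 1) ≡ N ∸ (q ∸ 1)
          lengths = trans (sym (length-drop (p ∸ 1) t)) (trans (cong length e) (length-drop (q ∸ 1) t))
          pred-eq : p ∸ 1 ≡ q ∸ 1
          pred-eq = ∸-cancelˡ-≡ (≤-trans (m∸n≤m p 1) b) (≤-trans (m∸n≤m q 1) d) lengths
      in trans (sym (m∸n+n≡m a)) (trans (cong (_+ 1) pred-eq) (m∸n+n≡m c))

    suf-last : suf t N ≡ δ ∷ []
    suf-last = trans (suf-cons N (1≤N , ≤-refl)) (cong₂ _∷_ chr-last (drop-all N t ≤-refl))

    sa-into : ∀ r → In N r → In N (sa r)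
    sa-into r (a , b) = proj₁ (proj₁ ha r a b) , proj₂ (proj₁ ha r a b)

    saPerm : Perm sa N
    saPerm = sa-into , λ x y (a , b) (c , d) e → proj₁ (proj₂ ha) x y a b c d e

    sa-mono : ∀ r r' → In N r → In N r' → r < r' → suf t (sa r) ≺ suf t (sa r')
    sa-mono r (suc r') (a , b) (c , d) (s≤s le) with m≤n⇒m<n∨m≡n le
    ... | inj₁ lt = lex-trans (sa-mono r r' (a , b) (≤-trans a le , ≤-trans (n≤1+n r') d) lt) (proj₂ (proj₂ ha) r' (≤-trans a le) d)
    ... | inj₂ refl = proj₂ (proj₂ ha) r a d

    prev : ℕ → ℕ
    prev p = if 1 <ᵇ p then p ∸ 1 else N

    prevPerm : Perm prev N
    prevPerm = into , inj
      where
      into : ∀ p → In N p → In N (prev p)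
      into (suc zero) _ = 1≤N , ≤-refl
      into (suc (suc k)) (a , b) = s≤s z≤n , ≤-trans (n≤1+n _) b
      inj : ∀ p q → In N p → In N q → prev p ≡ prev q → p ≡ q
      inj (suc zero) (suc zero) _ _ _ = refl
      inj (suc (suc k)) (suc (suc k')) _ _ e = cong suc e
      inj (suc zero) (suc (suc k')) _ (_ , b) e = ⊥-elim (1+n≰n (subst (suc (suc k') ≤_) e b))
      inj (suc (suc k)) (suc zero) (_ , b) _ e = ⊥-elim (1+n≰n (subst (suc (suc k) ≤_) (sym e) b))

    bwt-prev : ∀ r → bwt t sa r ≡ t ! prev (sa r)
    bwt-prev r with 1 <ᵇ sa r
    ... | true = refl
    ... | false = refl

    Sr : ℕ → Str
    Sr r = suf t (sa r)

    LF : ℕ → ℕ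
    LF r = inverse sa N (prev (sa r))

    LF-spec : ∀ r → In N r → In N (LF r) × sa (LF r) ≡ prev (sa r)
    LF-spec r ir = inverse-spec sa N saPerm _ (proj₁ prevPerm _ (sa-into r ir))

    LF-into : ∀ r → In N r → In N (LF r)
    LF-into r ir = proj₁ (LF-spec r ir)

    LFPerm : Perm LF N
    LFPerm = LF-into , λ x y ix iy e →
      proj₂ saPerm x y ix iy (proj₂ prevPerm _ _ (sa-into x ix) (sa-into y iy)
        (trans (sym (proj₂ (LF-spec x ix))) (trans (cong sa e) (proj₂ (LF-spec y iy)))))

    bwt-cases : ∀ r → In N r →
      (2 ≤ bwt t sa r × Sr (LF r) ≡ bwt t sa r ∷ Sr r) ⊎ (bwt t sa r ≡ δ × Sr (LF r) ≡ δ ∷ [])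
    bwt-cases r ir rewrite bwt-prev r | proj₂ (LF-spec r ir) = cases (sa r) (sa-into r ir)
      where
      cases : ∀ p → In N p → (2 ≤ t ! prev p × suf t (prev p) ≡ t ! prev p ∷ suf t p) ⊎ (t ! prev p ≡ δ × suf t (prev p) ≡ δ ∷ [])
      cases (suc zero) _ = inj₂ (chr-last , suf-last)
      cases (suc (suc k)) (a , b) = inj₁ (chr-mid (suc k) (s≤s z≤n) b , suf-cons (suc k) (s≤s z≤n , ≤-trans (n≤1+n _) b))

    -- The number of bwt symbols below c equals the number of suffixes
    -- whose first symbol is below c (both count the symbols of t below c).
    cnt-bwt : ∀ c → cntLess (bwt t sa) c N ≡ cnt (λ r → hd (Sr r) <ᵇ c) N
    cnt-bwt c = begin
        cntLess (bwt t sa) c N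
      ≡⟨ cntLess-cnt N ⟩
        cnt (λ r → bwt t sa r <ᵇ c) N
      ≡⟨ cnt-ext _ _ N (λ r _ → cong (_<ᵇ c) (bwt-prev r)) ⟩
        cnt (λ r → t ! prev (sa r) <ᵇ c) N
      ≡⟨ cnt-perm (λ p → t ! prev p <ᵇ c) sa N saPerm ⟩
        cnt (λ p → t ! prev p <ᵇ c) N
      ≡⟨ cnt-perm (λ q → t ! q <ᵇ c) prev N prevPerm ⟩
        cnt (λ q → t ! q <ᵇ c) N
      ≡⟨ sym (cnt-perm (λ q → t ! q <ᵇ c) sa N saPerm) ⟩
        cnt (λ r → t ! sa r <ᵇ c) N
      ≡⟨ cnt-ext _ _ N (λ r ir → cong (λ s → hd s <ᵇ c) (sym (suf-cons (sa r) (sa-into r ir)))) ⟩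
        cnt (λ r → hd (Sr r) <ᵇ c) N ∎
      where
      open ≡-Reasoning
      cntLess-cnt : ∀ m → cntLess (bwt t sa) c m ≡ cnt (λ i → bwt t sa i <ᵇ c) m
      cntLess-cnt zero = refl
      cntLess-cnt (suc m) rewrite cntLess-cnt m = refl

    Sr-inj : ∀ r r' → In N r → In N r' → Sr r ≡ Sr r' → r ≡ r'
    Sr-inj r r' ir ir' e = proj₂ saPerm r r' ir ir' (suf-inj _ _ (sa-into r ir) (sa-into r' ir') e)

    lastRank : ℕ
    lastRank = inverse sa N N

    lastRank-spec : In N lastRank × Sr lastRank ≡ δ ∷ []
    lastRank-spec = let sp = inverse-spec sa N saPerm N (1≤N , ≤-refl) in
      proj₁ sp , trans (cong (suf t) (proj₂ sp)) suf-last

module TwoTexts where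

  open import Data.Nat using (ℕ; zero; suc; _+_; _∸_; _≤_; _<_; _<ᵇ_; _≡ᵇ_; z≤n; s≤s)
  open import Data.Nat.Properties
  open import Data.Bool using (true; false; if_then_else_; _∧_; not)
  open import Data.Bool.Properties using (∧-zeroʳ)
  open import Data.List using ([]; _∷_; length; _++_)
  open import Data.List.Properties using (∷ʳ-injectiveʳ)
  open import Data.List.Relation.Unary.All using (All)
  open import Data.List.Relation.Binary.Lex.Core using (next)
  open import Data.Product using (Σ; _×_; _,_; proj₁; proj₂)
  open import Data.Sum using (_⊎_; inj₁; inj₂)
  open import Data.Empty using (⊥-elim)
  open import Relation.Nullary using (¬_)
  open import Relation.Binary.Definitions using (tri<; tri≈; tri>)
  open import Relation.Binary.PropositionalEquality
  open import Defs
  open Booleans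
  open Counting
  open Lex
  open OneText

  -- A merged index x ∈ [1, n], n = n0 + n1,
  -- stands for rank x of t0 when x ≤ n0 and for rank x - n0 of t1
  -- otherwise.
  module Two (σ : ℕ) (t0 t1 : Str) (sa0 sa1 : ℕ → ℕ)
    (hs0 : IsStr 0 σ t0) (hs1 : IsStr 1 σ t1) (ha0 : IsSA t0 sa0) (ha1 : IsSA t1 sa1) where

    module C0 = Text 0 σ t0 sa0 z≤n hs0 ha0
    module C1 = Text 1 σ t1 sa1 (s≤s z≤n) hs1 ha1

    n0 n1 n : ℕ
    n0 = length t0
    n1 = length t1
    n = n0 + n1

    col : ℕ → ℕ
    col x = if n0 <ᵇ x then 1 else 0

    S : ℕ → Str
    S x = if n0 <ᵇ x then C1.Sr (x ∸ n0) else C0.Sr x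

    chr : ℕ → ℕ
    chr x = if n0 <ᵇ x then bwt t1 sa1 (x ∸ n0) else bwt t0 sa0 x

    LFe : ℕ → ℕ
    LFe x = if n0 <ᵇ x then n0 + C1.LF (x ∸ n0) else C0.LF x

    data View : ℕ → Set where
      v0 : ∀ x → In n0 x → View x
      v1 : ∀ r → In n1 r → View (n0 + r)

    split : ∀ m x → x ≤ m ⊎ Σ ℕ λ r → (x ≡ m + r) × 1 ≤ r
    split zero zero = inj₁ z≤n
    split zero (suc x) = inj₂ (suc x , refl , s≤s z≤n)
    split (suc m) zero = inj₁ z≤n
    split (suc m) (suc x) with split m x
    ... | inj₁ le = inj₁ (s≤s le)
    ... | inj₂ (r , e , p) = inj₂ (r , cong suc e , p)

    view : ∀ x → In n x → View x
    view x (a , b) with split n0 x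
    ... | inj₁ le = v0 x (a , le)
    ... | inj₂ (r , refl , p) = v1 r (p , +-cancelˡ-≤ n0 r n1 b)

    lo : ∀ x → x ≤ n0 → (n0 <ᵇ x) ≡ false
    lo x le = ltb-false (≤⇒≯ le)

    hi : ∀ r → 1 ≤ r → (n0 <ᵇ (n0 + r)) ≡ true
    hi r p = ltb-intro (m<m+n n0 p)

    S0 : ∀ x → x ≤ n0 → S x ≡ C0.Sr x
    S0 x le rewrite lo x le = refl
    S1 : ∀ r → 1 ≤ r → S (n0 + r) ≡ C1.Sr r
    S1 r p rewrite hi r p | m+n∸m≡n n0 r = refl
    col0 : ∀ x → x ≤ n0 → col x ≡ 0
    col0 x le rewrite lo x le = refl
    col1 : ∀ r → 1 ≤ r → col (n0 + r) ≡ 1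
    col1 r p rewrite hi r p = refl
    chr0 : ∀ x → x ≤ n0 → chr x ≡ bwt t0 sa0 x
    chr0 x le rewrite lo x le = refl
    chr1 : ∀ r → 1 ≤ r → chr (n0 + r) ≡ bwt t1 sa1 r
    chr1 r p rewrite hi r p | m+n∸m≡n n0 r = refl
    LF0 : ∀ x → x ≤ n0 → LFe x ≡ C0.LF x
    LF0 x le rewrite lo x le = refl
    LF1 : ∀ r → 1 ≤ r → LFe (n0 + r) ≡ n0 + C1.LF r
    LF1 r p rewrite hi r p | m+n∸m≡n n0 r = refl

    In0 : ∀ {x} → In n0 x → In n x
    In0 (a , b) = a , ≤-trans b (m≤m+n n0 n1)
    In1 : ∀ {r} → In n1 r → In n (n0 + r)
    In1 (a , b) = ≤-trans a (m≤n+m _ n0) , +-monoʳ-≤ n0 b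

    col≤1 : ∀ x → col x ≤ 1
    col≤1 x with n0 <ᵇ x
    ... | true = ≤-refl
    ... | false = z≤n

    S-ends : ∀ x → In n x → Σ Str λ a → (S x ≡ a ++ (col x ∷ [])) × All (2 ≤_) a
    S-ends x ix with view x ix
    ... | v0 x i rewrite S0 x (proj₂ i) | col0 x (proj₂ i) = C0.suf-ends _ (C0.sa-into x i)
    ... | v1 r i rewrite S1 r (proj₁ i) | col1 r (proj₁ i) = C1.suf-ends _ (C1.sa-into r i)

    S-Ends : ∀ x → In n x → Ends (S x)
    S-Ends x ix = proj₁ (S-ends x ix) , col x , proj₁ (proj₂ (S-ends x ix)) , col≤1 x , proj₂ (proj₂ (S-ends x ix))

    -- Equal suffixes have the same terminator, hence the same colour ...
    S-col : ∀ x y → In n x → In n y → S x ≡ S y → col x ≡ col y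
    S-col x y ix iy e = ∷ʳ-injectiveʳ (proj₁ (S-ends x ix)) (proj₁ (S-ends y iy))
      (trans (sym (proj₁ (proj₂ (S-ends x ix)))) (trans e (proj₁ (proj₂ (S-ends y iy)))))

    S-inj : ∀ x y → In n x → In n y → S x ≡ S y → x ≡ y
    S-inj x y ix iy e with view x ix | view y iy
    ... | v0 x i | v0 y j = C0.Sr-inj x y i j (trans (sym (S0 x (proj₂ i))) (trans e (S0 y (proj₂ j))))
    ... | v1 r i | v1 r' j = cong (n0 +_) (C1.Sr-inj r r' i j (trans (sym (S1 r (proj₁ i))) (trans e (S1 r' (proj₁ j)))))
    ... | v0 x i | v1 r j = ⊥-elim (0≢1+n (trans (sym (col0 x (proj₂ i))) (trans (S-col x (n0 + r) ix iy e) (col1 r (proj₁ j)))))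
    ... | v1 r i | v0 y j = ⊥-elim (0≢1+n (trans (sym (col0 y (proj₂ j))) (trans (sym (S-col (n0 + r) y ix iy e)) (col1 r (proj₁ i)))))

    S-div : ∀ x y → In n x → In n y → ¬ x ≡ y → Div (S x) (S y)
    S-div x y ix iy ne = ends-div (S-Ends x ix) (S-Ends y iy) (λ e → ne (S-inj x y ix iy e))

    S-mono : ∀ x y → In n x → In n y → x < y → col x ≡ col y → S x ≺ S y
    S-mono x y ix iy lt ec with view x ix | view y iy
    ... | v0 x i | v0 y j rewrite S0 x (proj₂ i) | S0 y (proj₂ j) = C0.sa-mono x y i j lt
    ... | v1 r i | v1 r' j rewrite S1 r (proj₁ i) | S1 r' (proj₁ j) = C1.sa-mono r r' i j (+-cancelˡ-< n0 r r' lt)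
    ... | v0 x i | v1 r j = ⊥-elim (0≢1+n (trans (sym (col0 x (proj₂ i))) (trans ec (col1 r (proj₁ j)))))
    ... | v1 r i | v0 y j = ⊥-elim (0≢1+n (trans (sym (col0 y (proj₂ j))) (trans (sym ec) (col1 r (proj₁ i)))))

    LFe-into : ∀ x → In n x → In n (LFe x)
    LFe-into x ix with view x ix
    ... | v0 x i rewrite LF0 x (proj₂ i) = In0 (C0.LF-into x i)
    ... | v1 r i rewrite LF1 r (proj₁ i) = In1 (C1.LF-into r i)

    LFe-inj : ∀ x y → In n x → In n y → LFe x ≡ LFe y → x ≡ y
    LFe-inj x y ix iy e with view x ix | view y iy
    ... | v0 x i | v0 y j = proj₂ C0.LFPerm x y i j (trans (sym (LF0 x (proj₂ i))) (trans e (LF0 y (proj₂ j))))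
    ... | v1 r i | v1 r' j = cong (n0 +_) (proj₂ C1.LFPerm r r' i j (+-cancelˡ-≡ n0 _ _ (trans (sym (LF1 r (proj₁ i))) (trans e (LF1 r' (proj₁ j))))))
    ... | v0 x i | v1 r j = ⊥-elim (<⇒≱ (m<m+n n0 (proj₁ (C1.LF-into r j))) (subst (_≤ n0) (trans (sym (LF0 x (proj₂ i))) (trans e (LF1 r (proj₁ j)))) (proj₂ (C0.LF-into x i))))
    ... | v1 r i | v0 y j = ⊥-elim (<⇒≱ (m<m+n n0 (proj₁ (C1.LF-into r i))) (subst (_≤ n0) (trans (sym (LF0 y (proj₂ j))) (trans (sym e) (LF1 r (proj₁ i)))) (proj₂ (C0.LF-into y j))))

    LFePerm : Perm LFe n
    LFePerm = LFe-into , LFe-inj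

    LFe-col : ∀ x → In n x → col (LFe x) ≡ col x
    LFe-col x ix with view x ix
    ... | v0 x i rewrite LF0 x (proj₂ i) | col0 x (proj₂ i) = col0 _ (proj₂ (C0.LF-into x i))
    ... | v1 r i rewrite LF1 r (proj₁ i) | col1 r (proj₁ i) = col1 _ (proj₁ (C1.LF-into r i))

    chr-cases : ∀ x → In n x → (2 ≤ chr x × S (LFe x) ≡ chr x ∷ S x) ⊎ (chr x ≡ col x × S (LFe x) ≡ col x ∷ [])
    chr-cases x ix with view x ix
    ... | v0 x i rewrite chr0 x (proj₂ i) | LF0 x (proj₂ i) | S0 x (proj₂ i) | col0 x (proj₂ i) | S0 _ (proj₂ (C0.LF-into x i)) = C0.bwt-cases x i
    ... | v1 r i rewrite chr1 r (proj₁ i) | LF1 r (proj₁ i) | S1 r (proj₁ i) | col1 r (proj₁ i) | S1 _ (proj₁ (C1.LF-into r i)) = C1.bwt-cases r i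

    chr-big : ∀ x → In n x → 2 ≤ chr x → S (LFe x) ≡ chr x ∷ S x
    chr-big x ix c2 with chr-cases x ix
    ... | inj₁ (_ , e) = e
    ... | inj₂ (e , _) = ⊥-elim (1+n≰n (≤-trans c2 (subst (_≤ 1) (sym e) (col≤1 x))))

    hdLF : ∀ y → In n y → hd (S (LFe y)) ≡ chr y
    hdLF y iy with chr-cases y iy
    ... | inj₁ (_ , e) rewrite e = refl
    ... | inj₂ (c , e) rewrite e = sym c

    small-uniq : ∀ x y → In n x → In n y → chr y ≡ chr x → ¬ 2 ≤ chr x → y ≡ x
    small-uniq x y ix iy ec n2 with chr-cases x ix | chr-cases y iy
    ... | inj₁ (c2 , _) | _ = ⊥-elim (n2 c2)
    ... | inj₂ _ | inj₁ (c2 , _) = ⊥-elim (n2 (subst (2 ≤_) ec c2))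
    ... | inj₂ (cx , ex) | inj₂ (cy , ey) =
          LFe-inj y x iy ix (S-inj _ _ (LFe-into y iy) (LFe-into x ix) (trans ey (trans (cong (_∷ []) (trans (sym cy) (trans ec cx))) (sym ex))))

    cnt-hd : ∀ c → cnt (λ x → hd (S x) <ᵇ c) n ≡ cntLess (bwt t0 sa0) c n0 + cntLess (bwt t1 sa1) c n1
    cnt-hd c = trans (cnt-split (λ x → hd (S x) <ᵇ c) n0 n1)
      (cong₂ _+_ (trans (cnt-ext _ _ n0 (λ x i → cong (λ s → hd s <ᵇ c) (S0 x (proj₂ i)))) (sym (C0.cnt-bwt c)))
                 (trans (cnt-ext _ _ n1 (λ r i → cong (λ s → hd s <ᵇ c) (S1 r (proj₁ i)))) (sym (C1.cnt-bwt c))))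

    zS0 : Σ ℕ λ z → In n z × S z ≡ 0 ∷ []
    zS0 = C0.lastRank , In0 (proj₁ C0.lastRank-spec) , trans (S0 _ (proj₂ (proj₁ C0.lastRank-spec))) (proj₂ C0.lastRank-spec)

    S-cons : ∀ z → In n z → Σ ℕ λ d → Σ Str λ r → S z ≡ d ∷ r
    S-cons z iz = ends-nonempty (S-Ends z iz)

    -- Exactly b suffixes start with a symbol below b, for b ∈ {0, 1}
    -- (for b = 1 only the one-symbol suffix $_0).
    cnt-terminator-below : ∀ b → b ≤ 1 → cnt (λ z → hd (S z) <ᵇ b) n ≡ b
    cnt-terminator-below zero _ = cnt-false _ n (λ z _ → refl)
    cnt-terminator-below (suc zero) _ with zS0
    ... | z0 , iz0 , e0 = cnt-one _ n z0 iz0 (cong (_<ᵇ 1) (hd-eq e0)) only-z0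
      where
      only-z0 : ∀ z → In n z → (hd (S z) <ᵇ 1) ≡ true → z ≡ z0
      only-z0 z iz e with S-cons z iz
      ... | d , r , ez = S-inj z z0 iz iz0 (trans ez (trans (cong₂ _∷_ d0 (ends-head≤1 (subst Ends ez (S-Ends z iz)) (subst (_≤ 1) (sym d0) z≤n))) (sym e0)))
        where
        d0 : d ≡ 0
        d0 = n<1⇒n≡0 (subst (_< 1) (hd-eq ez) (ltb-true e))
    cnt-terminator-below (suc (suc b)) (s≤s ())

    Ord : ℕ → ℕ → Set
    Ord a b = (col a ≡ 0 × col b ≡ 1) ⊎ (col a ≡ col b × S a ≺ S b)

    ord⇒ : ∀ a b → In n a → In n b → a < b → Ord a b
    ord⇒ a b ia ib l with view a ia | view b ib
    ... | v0 a i | v0 b j = inj₂ (same (trans (col0 a (proj₂ i)) (sym (col0 b (proj₂ j)))))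
      where same = λ cc → cc , S-mono a b ia ib l cc
    ... | v1 r i | v1 r' j = inj₂ (same (trans (col1 r (proj₁ i)) (sym (col1 r' (proj₁ j)))))
      where same = λ cc → cc , S-mono (n0 + r) (n0 + r') ia ib l cc
    ... | v0 a i | v1 r j = inj₁ (col0 a (proj₂ i) , col1 r (proj₁ j))
    ... | v1 r i | v0 b j = ⊥-elim (1+n≰n (≤-trans (≤-trans (m<m+n n0 (proj₁ i)) (<⇒≤ l)) (proj₂ j)))

    ord⇐ : ∀ a b → In n a → In n b → Ord a b → a < b
    ord⇐ a b ia ib (inj₁ (c0 , c1)) = col-lt c0 c1
      where col-lt : col a ≡ 0 → col b ≡ 1 → a < b
            col-lt ca cb with n0 <ᵇ a in e1 | n0 <ᵇ b in e2
            ... | false | true = ≤-<-trans (ltb-false⇒ e1) (ltb-true e2)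
    ord⇐ a b ia ib (inj₂ (cc , sl)) with <-cmp a b
    ... | tri< l _ _ = l
    ... | tri≈ _ refl _ = ⊥-elim (lex-irrefl sl)
    ... | tri> _ _ l with ord⇒ b a ib ia l
    ...   | inj₁ (c0 , c1) = ⊥-elim (0≢1+n (trans (sym c0) (trans (sym cc) c1)))
    ...   | inj₂ (_ , sl') = ⊥-elim (lex-asym sl sl')

    -- LFe preserves the index order among suffixes preceded by the same
    -- symbol of Σ (prepending a common symbol preserves ≺).
    LF-order : ∀ x y → In n x → In n y → chr y ≡ chr x → 2 ≤ chr x → (LFe y <ᵇ LFe x) ≡ (y <ᵇ x)
    LF-order x y ix iy ec c2 with y <ᵇ x in e
    ... | true = ltb-intro (ord⇐ _ _ (LFe-into y iy) (LFe-into x ix) (fwd (ord⇒ y x iy ix (ltb-true e))))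
      where
      fwd : Ord y x → Ord (LFe y) (LFe x)
      fwd (inj₁ (c0 , c1)) = inj₁ (trans (LFe-col y iy) c0 , trans (LFe-col x ix) c1)
      fwd (inj₂ (cc , sl)) = inj₂ (trans (LFe-col y iy) (trans cc (sym (LFe-col x ix))) ,
        subst₂ _≺_ (sym (chr-big y iy (subst (2 ≤_) (sym ec) c2))) (sym (chr-big x ix c2))
          (subst (λ u → (u ∷ S y) ≺ (chr x ∷ S x)) (sym ec) (next refl sl)))
    ... | false = ltb-false (λ l → 1+n≰n (≤-trans (ord⇐ y x iy ix (bwd (ord⇒ _ _ (LFe-into y iy) (LFe-into x ix) l))) (ltb-false⇒ e)))
      where
      bwd : Ord (LFe y) (LFe x) → Ord y x
      bwd (inj₁ (c0 , c1)) = inj₁ (trans (sym (LFe-col y iy)) c0 , trans (sym (LFe-col x ix)) c1)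
      bwd (inj₂ (cc , sl)) = inj₂ (trans (sym (LFe-col y iy)) (trans cc (LFe-col x ix)) ,
        lex-cons (subst (λ u → (u ∷ S y) ≺ (chr x ∷ S x)) ec
          (subst₂ _≺_ (chr-big y iy (subst (2 ≤_) (sym ec) c2)) (chr-big x ix c2) sl)))

    rk : ℕ → ℕ
    rk x = if n0 <ᵇ x then x ∸ n0 else x

    rk-lo : ∀ x → x ≤ n0 → rk x ≡ x
    rk-lo x le rewrite lo x le = refl

    rk-hi : ∀ r → 1 ≤ r → rk (n0 + r) ≡ r
    rk-hi r p rewrite hi r p = m+n∸m≡n n0 r

    col-not0 : ∀ y → not (col y ≡ᵇ 0) ≡ (col y ≡ᵇ 1)
    col-not0 y with n0 <ᵇ y
    ... | true = refl
    ... | false = refl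

    cnt-samecol : ∀ x → In n x → suc (cnt (λ y → (y <ᵇ x) ∧ (col y ≡ᵇ col x)) n) ≡ rk x
    cnt-samecol x ix with view x ix
    ... | v0 x i rewrite col0 x (proj₂ i) | lo x (proj₂ i) =
          trans (cong suc (trans (cnt-ext _ (λ y → y <ᵇ x) n below) (cnt-below x n (≤-trans (proj₂ (In0 i)) (n≤1+n n)))))
                (suc-∸1 x (proj₁ i))
      where
      below : ∀ y → In n y → ((y <ᵇ x) ∧ (col y ≡ᵇ 0)) ≡ (y <ᵇ x)
      below y iy with y <ᵇ x in e
      ... | false = refl
      ... | true rewrite col0 y (≤-trans (<⇒≤ (ltb-true e)) (proj₂ i)) = refl
    ... | v1 r i rewrite col1 r (proj₁ i) | hi r (proj₁ i) | m+n∸m≡n n0 r =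
          trans (cong suc (trans (cnt-split _ n0 n1) (cong₂ _+_ (cnt-false _ n0 in-t0) (trans (cnt-ext _ (λ j → j <ᵇ r) n1 in-t1) (cnt-below r n1 (≤-trans (proj₂ i) (n≤1+n n1)))))))
                (suc-∸1 r (proj₁ i))
      where
      in-t0 : ∀ y → In n0 y → ((y <ᵇ (n0 + r)) ∧ (col y ≡ᵇ 1)) ≡ false
      in-t0 y iy rewrite col0 y (proj₂ iy) = ∧-zeroʳ _
      in-t1 : ∀ j → In n1 j → (((n0 + j) <ᵇ (n0 + r)) ∧ (col (n0 + j) ≡ᵇ 1)) ≡ (j <ᵇ r)
      in-t1 j ij rewrite col1 j (proj₁ ij) with j <ᵇ r in e
      ... | true = cong (_∧ true) (ltb-intro {n0 + j} {n0 + r} (+-monoʳ-< n0 (ltb-true e)))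
      ... | false = cong (_∧ true) (ltb-false {n0 + j} {n0 + r} (λ l → 1+n≰n (≤-trans l (+-monoʳ-≤ n0 (ltb-false⇒ e)))))

module PrefixOrder where

  open import Data.Nat using (ℕ; suc; _+_; _≤_; _<_; _<ᵇ_; _≡ᵇ_; z≤n; s≤s; _≟_)
  open import Data.Nat.Properties
  open import Data.Bool using (Bool; true; false; _∧_; _∨_)
  open import Data.Bool.Properties using (∧-zeroʳ; ∧-identityʳ)
  open import Data.List using (_∷_; take)
  open import Data.List.Properties using (∷-injectiveʳ)
  open import Data.Product using (Σ; _×_; _,_)
  open import Data.Sum using (_⊎_; inj₁; inj₂)
  open import Data.Empty using (⊥; ⊥-elim)
  open import Relation.Nullary using (¬_; yes; no)
  open import Relation.Binary.Definitions using (tri<; tri≈; tri>)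
  open import Relation.Binary.PropositionalEquality
  open import Defs
  open Booleans
  open Counting
  open Lex
  open OneText
  open TwoTexts

  -- Sorting the n suffixes by their first h symbols, ties broken by
  -- merged index.  pos h x is the position of x in this order; positions
  -- with equal h-prefix form a contiguous block, and a block boundary
  -- (Bd h i) is the first position of a block.  These are the objects
  -- the procedure computes in iteration h: Z^(h) lists the colours in
  -- this order and B marks the block boundaries.
  module HOrder (σ : ℕ) (t0 t1 : Str) (sa0 sa1 : ℕ → ℕ)
    (hs0 : IsStr 0 σ t0) (hs1 : IsStr 1 σ t1) (ha0 : IsSA t0 sa0) (ha1 : IsSA t1 sa1) where

    open Two σ t0 t1 sa0 sa1 hs0 hs1 ha0 ha1 public

    pre : ℕ → ℕ → Str
    pre h x = take h (S x)

    ltH : ℕ → ℕ → ℕ → Bool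
    ltH h x y = ltL (pre h x) (pre h y) ∨ (eqL (pre h x) (pre h y) ∧ (x <ᵇ y))

    LtH : ℕ → ℕ → ℕ → Set
    LtH h x y = pre h x ≺ pre h y ⊎ (pre h x ≡ pre h y × x < y)

    ltH-sound : ∀ h x y → ltH h x y ≡ true → LtH h x y
    ltH-sound h x y e with ltL (pre h x) (pre h y) in e1
    ... | true = inj₁ (ltL-sound _ _ e1)
    ... | false with eqL (pre h x) (pre h y) in e2 | x <ᵇ y in e3
    ...   | true | true = inj₂ (eqL-sound _ _ e2 , ltb-true e3)
    ...   | true | false = ⊥-elim (t≢f (sym e))
    ...   | false | _ = ⊥-elim (t≢f (sym e))

    ltH-complete : ∀ h x y → LtH h x y → ltH h x y ≡ true
    ltH-complete h x y (inj₁ p) rewrite ltL-complete p = refl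
    ltH-complete h x y (inj₂ (e , l)) rewrite e | ltL-false (pre h y) (pre h y) lex-irrefl | eqL-refl (pre h y) | ltb-intro l = refl

    ltH-false : ∀ h x y → ¬ LtH h x y → ltH h x y ≡ false
    ltH-false h x y ne = b≡f (λ e → ne (ltH-sound h x y e))

    LtH-irrefl : ∀ h x → ¬ LtH h x x
    LtH-irrefl h x (inj₁ p) = lex-irrefl p
    LtH-irrefl h x (inj₂ (_ , l)) = <-irrefl refl l

    LtH-trans : ∀ h x y z → LtH h x y → LtH h y z → LtH h x z
    LtH-trans h x y z (inj₁ p) (inj₁ q) = inj₁ (lex-trans p q)
    LtH-trans h x y z (inj₁ p) (inj₂ (e , _)) = inj₁ (subst (pre h x ≺_) e p)
    LtH-trans h x y z (inj₂ (e , _)) (inj₁ q) = inj₁ (subst (_≺ pre h z) (sym e) q)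
    LtH-trans h x y z (inj₂ (e , l)) (inj₂ (e' , l')) = inj₂ (trans e e' , <-trans l l')

    LtH-tri : ∀ h x y → ¬ x ≡ y → LtH h x y ⊎ LtH h y x
    LtH-tri h x y ne with lex-cmp (pre h x) (pre h y)
    ... | tlt p = inj₁ (inj₁ p)
    ... | tgt p = inj₂ (inj₁ p)
    ... | teq e with <-cmp x y
    ...   | tri< l _ _ = inj₁ (inj₂ (e , l))
    ...   | tri≈ _ e' _ = ⊥-elim (ne e')
    ...   | tri> _ _ l = inj₂ (inj₂ (sym e , l))

    LtH-asym : ∀ h x y → LtH h x y → ¬ LtH h y x
    LtH-asym h x y p q = LtH-irrefl h x (LtH-trans h x y x p q)

    -- Within one text the h-order agrees with the index order, since
    -- indices of one text are sorted by suffix.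
    samecol-lt : ∀ h x y → In n x → In n y → col x ≡ col y → x < y → LtH h x y
    samecol-lt h x y ix iy ec l with take-mono h (S-mono x y ix iy l ec)
    ... | inj₁ p = inj₁ p
    ... | inj₂ e = inj₂ (e , l)

    samecol-lt⇒ : ∀ h x y → In n x → In n y → col x ≡ col y → LtH h x y → x < y
    samecol-lt⇒ h x y ix iy ec p with <-cmp x y
    ... | tri< l _ _ = l
    ... | tri≈ _ refl _ = ⊥-elim (LtH-irrefl h x p)
    ... | tri> _ _ l = ⊥-elim (LtH-asym h x y p (samecol-lt h y x iy ix (sym ec) l))

    pos : ℕ → ℕ → ℕ
    pos h y = suc (cnt (λ x → ltH h x y) n)

    C D G : ℕ → ℕ → ℕ
    C h y = cnt (λ x → ltL (pre h x) (pre h y)) n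
    D h y = cnt (λ x → eqL (pre h x) (pre h y) ∧ (x <ᵇ y)) n
    G h y = cnt (λ x → eqL (pre h x) (pre h y)) n

    lt-eq-disj : ∀ a b → (ltL a b ∧ eqL a b) ≡ false
    lt-eq-disj a b with ltL a b in e1
    ... | false = refl
    ... | true = eqL-false a b (λ e → lex-irrefl (subst (a ≺_) (sym e) (ltL-sound a b e1)))

    pos-split : ∀ h y → pos h y ≡ suc (C h y + D h y)
    pos-split h y = cong suc (cnt-or _ _ n (λ x _ → exclusive (pre h x) (pre h y) (x <ᵇ y)))
      where exclusive : ∀ a b c → (ltL a b ∧ (eqL a b ∧ c)) ≡ false
            exclusive a b c with ltL a b in e1 | eqL a b in e2
            ... | false | _ = refl
            ... | true | false = refl
            ... | true | true = ⊥-elim (t≢f (subst₂ (λ u v → (u ∧ v) ≡ false) e1 e2 (lt-eq-disj a b)))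

    pos-into : ∀ h y → In n y → In n (pos h y)
    pos-into h y iy = s≤s z≤n , subst (suc (cnt (λ x → ltH h x y) n) ≤_) (cnt-true n)
      (cnt-strict _ (λ _ → true) n (λ _ _ _ → refl) y iy (ltH-false h y y (LtH-irrefl h y)) refl)

    pos-lt : ∀ h x y → In n x → In n y → LtH h x y → pos h x < pos h y
    pos-lt h x y ix iy p = s≤s (cnt-strict (λ z → ltH h z x) (λ z → ltH h z y) n
      (λ z iz e → ltH-complete h z y (LtH-trans h z x y (ltH-sound h z x e) p)) x ix (ltH-false h x x (LtH-irrefl h x)) (ltH-complete h x y p))

    pos-inj : ∀ h x y → In n x → In n y → pos h x ≡ pos h y → x ≡ y
    pos-inj h x y ix iy e with x ≟ y
    ... | yes xy = xy
    ... | no ne with LtH-tri h x y ne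
    ...   | inj₁ p = ⊥-elim (<-irrefl e (pos-lt h x y ix iy p))
    ...   | inj₂ p = ⊥-elim (<-irrefl (sym e) (pos-lt h y x iy ix p))

    posPerm : ∀ h → Perm (pos h) n
    posPerm h = pos-into h , pos-inj h

    pos-lt⇒ : ∀ h x y → In n x → In n y → pos h x < pos h y → LtH h x y
    pos-lt⇒ h x y ix iy l with x ≟ y
    ... | yes refl = ⊥-elim (<-irrefl refl l)
    ... | no ne with LtH-tri h x y ne
    ...   | inj₁ p = p
    ...   | inj₂ p = ⊥-elim (<-asym l (pos-lt h y x iy ix p))

    pos-ge : ∀ h y → suc (C h y) ≤ pos h y
    pos-ge h y rewrite pos-split h y = s≤s (m≤m+n _ _)

    pos-le : ∀ h y → In n y → pos h y ≤ C h y + G h y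
    pos-le h y iy = subst (_≤ C h y + G h y) (trans (+-suc (C h y) (D h y)) (sym (pos-split h y))) (+-monoʳ-≤ (C h y)
      (cnt-strict (λ x → eqL (pre h x) (pre h y) ∧ (x <ᵇ y)) (λ x → eqL (pre h x) (pre h y)) n (λ x _ e → ∧-true-left e) y iy
        (subst (λ u → (eqL (pre h y) (pre h y) ∧ u) ≡ false) (sym (ltb-false {y} {y} (<-irrefl refl))) (∧-zeroʳ _))
        (eqL-refl (pre h y))))

    blk-lt : ∀ h x z → pre h x ≺ pre h z → C h x + G h x ≤ C h z
    blk-lt h x z p = subst (_≤ C h z) (cnt-or (λ w → ltL (pre h w) (pre h x)) (λ w → eqL (pre h w) (pre h x)) n (λ w _ → lt-eq-disj (pre h w) (pre h x)))
      (cnt-mono (λ w → ltL (pre h w) (pre h x) ∨ eqL (pre h w) (pre h x)) (λ w → ltL (pre h w) (pre h z)) n (λ w _ e → below-z (pre h w) e))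
      where below-z : ∀ a → (ltL a (pre h x) ∨ eqL a (pre h x)) ≡ true → ltL a (pre h z) ≡ true
            below-z a e with ltL a (pre h x) in e1
            ... | true = ltL-complete (lex-trans (ltL-sound a (pre h x) e1) p)
            ... | false = ltL-complete (subst (_≺ pre h z) (sym (eqL-sound a (pre h x) e)) p)

    C-eq : ∀ h x z → pre h x ≡ pre h z → C h x ≡ C h z
    C-eq h x z e = cnt-ext _ _ n (λ w _ → cong (ltL (pre h w)) e)

    Bd : ℕ → ℕ → Set
    Bd h i = Σ ℕ λ z → In n z × i ≡ suc (C h z)

    first-bd : ∀ h x → In n x → D h x ≡ 0 → Bd h (pos h x)
    first-bd h x ix d0 = x , ix , trans (pos-split h x) (cong suc (trans (cong (C h x +_) d0) (+-identityʳ _)))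

    notfirst : ∀ h x → In n x → 1 ≤ D h x → ¬ Bd h (pos h x)
    notfirst h x ix d1 (z , iz , e) = go (lex-cmp (pre h z) (pre h x))
      where
      go : Tri3 (pre h z) (pre h x) → ⊥
      go (tlt p) = <-irrefl (sym e) (≤-trans (s≤s (≤-trans (pos-ge h z) (≤-trans (pos-le h z iz) (blk-lt h z x p)))) (pos-ge h x))
      go (teq q) = <-irrefl (sym e) (subst (λ u → suc u < pos h x) (sym (C-eq h z x q)) (subst (suc (C h x) <_) (sym (pos-split h x)) (s≤s (subst (_≤ C h x + D h x) (+-comm (C h x) 1) (+-monoʳ-≤ (C h x) d1)))))
      go (tgt p) = <-irrefl e (s≤s (≤-trans (pos-le h x ix) (blk-lt h x z p)))

    same-nobd : ∀ h y' y → In n y' → In n y → pre h y' ≡ pre h y → ∀ i → pos h y' < i → i ≤ pos h y → ¬ Bd h i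
    same-nobd h y' y iy' iy e i l1 l2 (z , iz , ei) = go (lex-cmp (pre h z) (pre h y))
      where
      go : Tri3 (pre h z) (pre h y) → ⊥
      go (tlt p) = <-irrefl refl (≤-trans l1 (subst (_≤ pos h y') (sym ei)
            (≤-trans (pos-ge h z) (≤-trans (pos-le h z iz) (≤-trans (blk-lt h z y p) (≤-trans (n≤1+n _) (subst (λ u → suc u ≤ pos h y') (C-eq h y' y e) (pos-ge h y'))))))))
      go (teq q) = <-irrefl refl (≤-trans l1 (subst (_≤ pos h y') (sym ei) (subst (λ u → suc u ≤ pos h y') (trans (C-eq h y' y e) (sym (C-eq h z y q))) (pos-ge h y'))))
      go (tgt p) = <-irrefl refl (≤-trans (s≤s (≤-trans (pos-le h y iy) (blk-lt h y z p))) (subst (_≤ pos h y) ei l2))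

    diff-bd : ∀ h y' y → In n y' → In n y → pos h y' < pos h y → ¬ pre h y' ≡ pre h y →
      Σ ℕ λ i → pos h y' < i × i ≤ pos h y × Bd h i
    diff-bd h y' y iy' iy l ne = go (lex-cmp (pre h y') (pre h y))
      where
      go : Tri3 (pre h y') (pre h y) → Σ ℕ λ i → pos h y' < i × i ≤ pos h y × Bd h i
      go (tlt p) = suc (C h y) , s≤s (≤-trans (pos-le h y' iy') (blk-lt h y' y p)) , pos-ge h y , y , iy , refl
      go (teq q) = ⊥-elim (ne q)
      go (tgt p) = ⊥-elim (<-asym l (≤-trans (s≤s (≤-trans (pos-le h y iy) (blk-lt h y y' p))) (pos-ge h y')))

    pos-lt-b : ∀ h y x → In n y → In n x → (pos h y <ᵇ pos h x) ≡ ltH h y x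
    pos-lt-b h y x iy ix with ltH h y x in e
    ... | true = ltb-intro (pos-lt h y x iy ix (ltH-sound h y x e))
    ... | false = ltb-false (λ l → t≢f (trans (sym (ltH-complete h y x (pos-lt⇒ h y x iy ix l))) e))

    ltH-samecol : ∀ h y x → In n y → In n x → col y ≡ col x → ltH h y x ≡ (y <ᵇ x)
    ltH-samecol h y x iy ix cc = by-index (y <ᵇ x) refl
      where
      by-index : ∀ b → (y <ᵇ x) ≡ b → ltH h y x ≡ (y <ᵇ x)
      by-index true e = trans (ltH-complete h y x (samecol-lt h y x iy ix cc (ltb-true e))) (sym e)
      by-index false e = trans (ltH-false h y x (λ p → t≢f (trans (sym (ltb-intro (samecol-lt⇒ h y x iy ix cc p))) e))) (sym e)

    pos-lt-same : ∀ h y x → In n y → In n x → pre h y ≡ pre h x → pos h y < pos h x → y < x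
    pos-lt-same h y x iy ix eq l with pos-lt⇒ h y x iy ix l
    ... | inj₁ p = ⊥-elim (lex-irrefl (subst (_≺ pre h x) eq p))
    ... | inj₂ (_ , l') = l'

    pre-LF : ∀ H x → In n x → 2 ≤ chr x → pre (suc H) (LFe x) ≡ chr x ∷ pre H x
    pre-LF H x ix c2 = cong (take (suc H)) (chr-big x ix c2)

    hd-pre-LF : ∀ H y → In n y → hd (pre (suc H) (LFe y)) ≡ chr y
    hd-pre-LF H y iy = trans (hd-take H (S (LFe y))) (hdLF y iy)

    LF-pre-chr : ∀ H x y → In n x → In n y → pre (suc H) (LFe y) ≡ pre (suc H) (LFe x) → chr y ≡ chr x
    LF-pre-chr H x y ix iy e = trans (sym (hd-pre-LF H y iy)) (trans (cong hd e) (hd-pre-LF H x ix))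

    LF-pre⇒ : ∀ H x y → In n x → In n y → chr y ≡ chr x → 2 ≤ chr x →
      pre (suc H) (LFe y) ≡ pre (suc H) (LFe x) → pre H y ≡ pre H x
    LF-pre⇒ H x y ix iy ec c2 e =
      ∷-injectiveʳ (trans (sym (pre-LF H y iy (subst (2 ≤_) (sym ec) c2))) (trans e (pre-LF H x ix c2)))

    LF-pre⇐ : ∀ H x y → In n x → In n y → chr y ≡ chr x → 2 ≤ chr x →
      pre H y ≡ pre H x → pre (suc H) (LFe y) ≡ pre (suc H) (LFe x)
    LF-pre⇐ H x y ix iy ec c2 e =
      trans (pre-LF H y iy (subst (2 ≤_) (sym ec) c2)) (trans (cong₂ _∷_ ec e) (sym (pre-LF H x ix c2)))

    ltH-split : ∀ H x z → In n x → In n z → (c : ℕ) → S (LFe x) ≡ c ∷ S x →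
      ltH (suc H) z (LFe x) ≡ ((hd (S z) <ᵇ c) ∨ ((hd (S z) ≡ᵇ c) ∧ ltH (suc H) z (LFe x)))
    ltH-split H x z ix iz c ex with S-cons z iz
    ... | d , r , ez rewrite hd-eq ez =
          cons-split (pre (suc H) z) (pre (suc H) (LFe x)) d c (take H r) (pre H x) z (LFe x)
            (cong (take (suc H)) ez) (cong (take (suc H)) ex)

    ltH-LF : ∀ H x y → In n x → In n y → 2 ≤ chr x →
      ((hd (S (LFe y)) ≡ᵇ chr x) ∧ ltH (suc H) (LFe y) (LFe x)) ≡ ((pos H y <ᵇ pos H x) ∧ (chr y ≡ᵇ chr x))
    ltH-LF H x y ix iy c2 rewrite hdLF y iy with chr y ≟ chr x
    ... | no ne rewrite eqb-false ne | ∧-zeroʳ (pos H y <ᵇ pos H x) = refl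
    ... | yes ec rewrite ec | eqb-refl (chr x) =
          trans (cons-same (pre (suc H) (LFe y)) (pre (suc H) (LFe x)) (chr x) (pre H y) (pre H x) (LFe y <ᵇ LFe x)
                   (trans (pre-LF H y iy (subst (2 ≤_) (sym ec) c2)) (cong (_∷ pre H y) ec)) (pre-LF H x ix c2))
            (trans (cong (λ g → ltL (pre H y) (pre H x) ∨ (eqL (pre H y) (pre H x) ∧ g)) (LF-order x y ix iy ec c2))
              (trans (sym (pos-lt-b H y x iy ix)) (sym (∧-identityʳ _))))

module Concat where

  open import Data.Nat using (ℕ; suc; _+_; _∸_; _≤_; _<_; _<ᵇ_; z≤n; s≤s; _≟_)
  open import Data.Nat.Properties
  open import Data.Bool using (Bool; true; false; if_then_else_)
  open import Data.List using ([]; length; take; _++_)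
  open import Data.List.Properties using (length-++; ++-identityʳ)
  open import Data.Product using (_×_; _,_; proj₁; proj₂)
  open import Data.Sum using (_⊎_; inj₁; inj₂)
  open import Data.Empty using (⊥-elim)
  open import Relation.Nullary using (¬_; yes; no)
  open import Relation.Binary.PropositionalEquality
  open import Defs
  open Booleans
  open Counting
  open Lex
  open OneText
  open TwoTexts
  open PrefixOrder

  -- The
  -- suffix of t01 at position pp x is S x followed by w x (t1 if x is a
  -- suffix of t0, nothing otherwise).  Since S x and S y always diverge,
  -- these tails do not matter: the sorted order of t01 (through the
  -- permutation einv) is the sorted order of the S x, and lcp_01 is the
  -- lcp of consecutive S's.  Consequently the block boundaries of the
  -- h-order are exactly position 1 and the i ≥ 2 with lcp_01[i] < h.
  module Suffixes01 (σ : ℕ) (t0 t1 : Str) (sa0 sa1 sa01 : ℕ → ℕ)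
    (hs0 : IsStr 0 σ t0) (hs1 : IsStr 1 σ t1) (ha0 : IsSA t0 sa0) (ha1 : IsSA t1 sa1)
    (ha01 : IsSA (t0 ++ t1) sa01) where

    open HOrder σ t0 t1 sa0 sa1 hs0 hs1 ha0 ha1 public

    T : ℕ → Str
    T p = suf (t0 ++ t1) p

    pp : ℕ → ℕ
    pp x = if n0 <ᵇ x then n0 + sa1 (x ∸ n0) else sa0 x

    w : ℕ → Str
    w x = if n0 <ᵇ x then [] else t1

    len01 : length (t0 ++ t1) ≡ n
    len01 = length-++ t0

    T-pp : ∀ x → In n x → T (pp x) ≡ S x ++ w x
    T-pp x ix with view x ix
    ... | v0 x i rewrite lo x (proj₂ i) = drop-app (sa0 x ∸ 1) t0 t1 (≤-trans (m∸n≤m _ 1) (proj₂ (C0.sa-into x i)))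
    ... | v1 r i rewrite hi r (proj₁ i) | m+n∸m≡n n0 r | +-∸-assoc n0 {sa1 r} {1} (proj₁ (C1.sa-into r i)) =
          trans (drop-app2 (sa1 r ∸ 1) t0 t1) (sym (++-identityʳ _))

    pp-into : ∀ x → In n x → In n (pp x)
    pp-into x ix with view x ix
    ... | v0 x i rewrite lo x (proj₂ i) = In0 (C0.sa-into x i)
    ... | v1 r i rewrite hi r (proj₁ i) | m+n∸m≡n n0 r = In1 (C1.sa-into r i)

    pp-inj : ∀ x y → In n x → In n y → pp x ≡ pp y → x ≡ y
    pp-inj x y ix iy e = S-inj x y ix iy (div-eq (trans (sym (T-pp x ix)) (trans (cong T e) (T-pp y iy))))
      where
      div-eq : S x ++ w x ≡ S y ++ w y → S x ≡ S y
      div-eq e' with x ≟ y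
      ... | yes refl = refl
      ... | no ne = ⊥-elim (div-neq (div-app (w x) (w y) (S-div x y ix iy ne)) e')

    ppPerm : Perm pp n
    ppPerm = pp-into , pp-inj

    sa01-into : ∀ i → In n i → In n (sa01 i)
    sa01-into i (a , b) = proj₁ (proj₁ ha01 i a (subst (i ≤_) (sym len01) b)) , subst (sa01 i ≤_) len01 (proj₂ (proj₁ ha01 i a (subst (i ≤_) (sym len01) b)))

    sa01-inj : ∀ i j → In n i → In n j → sa01 i ≡ sa01 j → i ≡ j
    sa01-inj i j (a , b) (c , d) e = proj₁ (proj₂ ha01) i j a (subst (i ≤_) (sym len01) b) c (subst (j ≤_) (sym len01) d) e

    einv : ℕ → ℕ
    einv i = inverse pp n (sa01 i)

    einv-spec : ∀ i → In n i → In n (einv i) × pp (einv i) ≡ sa01 i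
    einv-spec i ii = inverse-spec pp n ppPerm (sa01 i) (sa01-into i ii)

    einvPerm : Perm einv n
    einvPerm = (λ i ii → proj₁ (einv-spec i ii)) , λ i j ii ij e →
      sa01-inj i j ii ij (trans (sym (proj₂ (einv-spec i ii))) (trans (cong pp e) (proj₂ (einv-spec j ij))))

    U : ℕ → Str
    U i = S (einv i)

    T-U : ∀ i → In n i → T (sa01 i) ≡ U i ++ w (einv i)
    T-U i ii = trans (cong T (sym (proj₂ (einv-spec i ii)))) (T-pp _ (proj₁ (einv-spec i ii)))

    U-div : ∀ i j → In n i → In n j → ¬ i ≡ j → Div (U i) (U j)
    U-div i j ii ij ne = S-div _ _ (proj₁ (einv-spec i ii)) (proj₁ (einv-spec j ij)) (λ e → ne (proj₂ einvPerm i j ii ij e))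

    U-div-next : ∀ k → 1 ≤ k → suc k ≤ n → Div (U k) (U (suc k))
    U-div-next k a b = U-div k (suc k) (a , <⇒≤ b) (s≤s z≤n , b) (λ e → 1+n≰n (≤-reflexive (sym e)))

    U-step : ∀ i → 1 ≤ i → i < n → U i ≺ U (suc i)
    U-step i a b = div-lex⇒ (w (einv i)) (w (einv (suc i))) (U-div-next i a b)
      (subst₂ _≺_ (T-U i (a , <⇒≤ b)) (T-U (suc i) (s≤s z≤n , b)) (proj₂ (proj₂ ha01) i a (subst (i <_) (sym len01) b)))

    U-mono : ∀ i j → 1 ≤ i → j ≤ n → i < j → U i ≺ U j
    U-mono i (suc j) a b (s≤s le) with m≤n⇒m<n∨m≡n le
    ... | inj₁ l = lex-trans (U-mono i j a (≤-trans (n≤1+n j) b) l) (U-step j (≤-trans a le) b)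
    ... | inj₂ refl = U-step i a b

    preU-le : ∀ h i j → 1 ≤ i → j ≤ n → i ≤ j → take h (U i) ≺ take h (U j) ⊎ take h (U i) ≡ take h (U j)
    preU-le h i j a b le with m≤n⇒m<n∨m≡n le
    ... | inj₁ l = take-mono h (U-mono i j a b l)
    ... | inj₂ refl = inj₂ refl

    ℓ : ℕ → ℕ
    ℓ i = lcp01 t0 t1 sa01 i

    -- lcp_01 only sees the diverging parts U i, U (i+1).
    ℓ-U : ∀ k → 1 ≤ k → suc k ≤ n → ℓ (suc k) ≡ lcpLen (U k) (U (suc k))
    ℓ-U k a b = trans (cong₂ lcpLen (T-U k (a , <⇒≤ b)) (T-U (suc k) (s≤s z≤n , b)))
      (div-lcp _ _ (U-div-next k a b))

    C-U : ∀ h z → C h z ≡ cnt (λ j → ltL (take h (U j)) (pre h z)) n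
    C-U h z = sym (cnt-perm (λ x → ltL (take h (S x)) (pre h z)) einv n einvPerm)

    not-lt-of-le : ∀ {a b} → (b ≺ a ⊎ b ≡ a) → ltL a b ≡ false
    not-lt-of-le {a} {b} (inj₁ p) = ltL-false a b (lex-asym p)
    not-lt-of-le {a} {b} (inj₂ refl) = ltL-false a a lex-irrefl

    bd-lt : ∀ h k → 1 ≤ k → suc k ≤ n → ℓ (suc k) < h → Bd h (suc k)
    bd-lt h k a b lt = einv (suc k) , proj₁ (einv-spec (suc k) (s≤s z≤n , b)) ,
      cong suc (sym (trans (C-U h (einv (suc k))) (trans (cnt-ext _ _ n below-iff) (cnt-below (suc k) n (≤-trans b (n≤1+n n))))))
      where
      prefixes-ordered : take h (U k) ≺ take h (U (suc k))
      prefixes-ordered = div-take-lt h (U-div-next k a b)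
              (subst (_< h) (ℓ-U k a b) lt) (U-step k a b)
      below-iff : ∀ j → In n j → ltL (take h (U j)) (pre h (einv (suc k))) ≡ (j <ᵇ suc k)
      below-iff j (c , d) with j <ᵇ suc k in e
      ... | true = ltL-complete (via-k (preU-le h j k c (≤-trans (n≤1+n k) b) (≤-pred (ltb-true e))))
        where via-k : take h (U j) ≺ take h (U k) ⊎ take h (U j) ≡ take h (U k) → take h (U j) ≺ take h (U (suc k))
              via-k (inj₁ p) = lex-trans p prefixes-ordered
              via-k (inj₂ q) = subst (_≺ take h (U (suc k))) (sym q) prefixes-ordered
      ... | false = not-lt-of-le (preU-le h (suc k) j (s≤s z≤n) d (ltb-false⇒ e))

    -- ... and if lcp_01[k+1] ≥ h it is not (U k and U (k+1) share
    -- their h-prefix, so the block of U k continues).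
    bd-ge : ∀ h k → 1 ≤ k → suc k ≤ n → h ≤ ℓ (suc k) → ¬ Bd h (suc k)
    bd-ge h k a b le (z , iz , e) = t≢f (trans (sym (proj₁ edge)) (trans (cong (λ s → ltL s (pre h z)) same-prefix) (proj₂ edge)))
      where
      Below : ℕ → Bool
      Below j = ltL (take h (U j)) (pre h z)
      Below-closed : ∀ j j' → 1 ≤ j' → j' ≤ j → j ≤ n → Below j ≡ true → Below j' ≡ true
      Below-closed j j' a' l jn pj with preU-le h j' j a' jn l
      ... | inj₁ p = ltL-complete (lex-trans p (ltL-sound _ _ pj))
      ... | inj₂ q = trans (cong (λ s → ltL s (pre h z)) q) pj
      edge : Below k ≡ true × Below (suc k) ≡ false
      edge = downclosed-count Below n Below-closed k a b (trans (sym (C-U h z)) (suc-injective (sym e)))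
      same-prefix : take h (U k) ≡ take h (U (suc k))
      same-prefix = div-take-eq h (U-div-next k a b) (subst (h ≤_) (ℓ-U k a b) le)

module Iteration where


  open import Data.Nat using (ℕ; zero; suc; _+_; _∸_; _≤_; _<_; _<ᵇ_; _≡ᵇ_; z≤n; s≤s; _≟_)
  open import Data.Nat.Properties
  open import Data.Bool using (Bool; true; false; if_then_else_; _∧_; not)
  open import Data.Bool.Properties using (∧-zeroʳ; not-injective)
  open import Data.Maybe using (Maybe; just; nothing)
  open import Data.Product using (Σ; _×_; _,_)
  open import Data.Sum using (_⊎_; inj₁; inj₂)
  open import Data.Empty using (⊥; ⊥-elim)
  open import Relation.Nullary using (¬_; yes; no)
  open import Relation.Binary.PropositionalEquality
  open import Defs
  open Booleans
  open Counting

  eqM-true : ∀ m a → eqM m a ≡ true → m ≡ just a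
  eqM-true nothing a ()
  eqM-true (just b) a e = cong just (eqb-true e)

  upd-same : ∀ {A : Set} (f : ℕ → A) j v → upd f j v j ≡ v
  upd-same f j v rewrite eqb-refl j = refl

  upd-other : ∀ {A : Set} (f : ℕ → A) j v x → ¬ x ≡ j → upd f j v x ≡ f x
  upd-other f j v x ne rewrite eqb-false ne = refl

  -- We describe the loop in closed form: at step k it reads the symbol
  -- readSym k (the counters k0, k1 equal 1 + the number of 0s / 1s among
  -- Zp[1 .. k-1]), writes Zp[k] to Z^(h)[dest k] (the running counter
  -- F[c]), the variable id equals curId k (the last step i ≤ k with
  -- B[i] set by an earlier iteration, or 0), and Block_id[c] equals
  -- lastId k c.  Step k marks B[dest k] with h iff it is fresh (no
  -- earlier step reading the same symbol saw the current id) and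
  -- B[dest k] was still 0.
  module OneIteration (bwt0 bwt1 : ℕ → ℕ) (n0 n1 : ℕ) (h : ℕ) (Zp B₀ : ℕ → ℕ) where
    open Procedure bwt0 bwt1 n0 n1

    initState : St
    initState = st 1 1 F₀ (λ _ → nothing) 0 (λ _ → 0) B₀

    stateAfter : ℕ → St
    stateAfter k = steps h Zp initState 1 k

    steps-suc : ∀ s f m → steps h Zp s f (suc m) ≡ step h Zp (steps h Zp s f m) (f + m)
    steps-suc s f zero = cong (step h Zp s) (sym (+-identityʳ f))
    steps-suc s f (suc m) = trans (steps-suc (step h Zp s f) (suc f) m) (cong (step h Zp (steps h Zp (step h Zp s f) (suc f) m)) (sym (+-suc f m)))

    stateAfter-suc : ∀ k → stateAfter (suc k) ≡ step h Zp (stateAfter k) (suc k)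
    stateAfter-suc k = steps-suc initState 1 k

    module Local (s : St) (K : ℕ) where
      idS : ℕ
      idS = if not (B s K ≡ᵇ 0) ∧ not (B s K ≡ᵇ h) then K else ident s
      cS : ℕ
      cS = if Zp K ≡ᵇ 0 then bwt0 (k0 s) else bwt1 (k1 s)
      jS : ℕ
      jS = if 1 <ᵇ cS then F s cS else suc (Zp K)
      frS : Bool
      frS = not (eqM (blk s cS) idS)
      s' : St
      s' = step h Zp s K

    isZero : ℕ → Bool
    isZero j = Zp j ≡ᵇ 0
    isOne : ℕ → Bool
    isOne j = not (Zp j ≡ᵇ 0)

    readSym : ℕ → ℕ
    readSym k = if Zp k ≡ᵇ 0 then bwt0 (suc (cnt isZero (k ∸ 1))) else bwt1 (suc (cnt isOne (k ∸ 1)))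

    dest : ℕ → ℕ
    dest k = if 1 <ᵇ readSym k then F₀ (readSym k) + cnt (λ j → readSym j ≡ᵇ readSym k) (k ∸ 1) else suc (Zp k)

    -- step i resets id: B[i] is a boundary set by an earlier iteration
    opens : ℕ → Bool
    opens i = not (B₀ i ≡ᵇ 0) ∧ not (B₀ i ≡ᵇ h)

    curId : ℕ → ℕ
    curId zero = 0
    curId (suc k) = if opens (suc k) then suc k else curId k

    lastId : ℕ → ℕ → Maybe ℕ
    lastId zero c = nothing
    lastId (suc k) c = if readSym (suc k) ≡ᵇ c then just (curId (suc k)) else lastId k c

    fresh : ℕ → Bool
    fresh k = not (eqM (lastId (k ∸ 1) (readSym k)) (curId k))

    written : ℕ → ℕ
    written k = if fresh k ∧ (B₀ (dest k) ≡ᵇ 0) then h else B₀ (dest k)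

    record Tracks (q : St) (k : ℕ) : Set where
      field
        k0-eq : k0 q ≡ suc (cnt isZero k)
        k1-eq : k1 q ≡ suc (cnt isOne k)
        F-eq : ∀ c → F q c ≡ F₀ c + cnt (λ j → (1 <ᵇ c) ∧ (readSym j ≡ᵇ c)) k
        id-eq : ident q ≡ curId k
        blk-eq : ∀ c → blk q c ≡ lastId k c
        B-eq : ∀ x → B q x ≡ B₀ x ⊎ (B₀ x ≡ 0 × B q x ≡ h)

    TracksAt : ℕ → Set
    TracksAt k = Tracks (stateAfter k) k

    tracks-init : TracksAt 0
    tracks-init = record { k0-eq = refl ; k1-eq = refl ; F-eq = λ c → sym (+-identityʳ _) ; id-eq = refl ; blk-eq = λ c → refl ; B-eq = λ x → inj₁ refl }

    module TrackStep (k : ℕ) (I : TracksAt k) where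
      open Tracks I
      K : ℕ
      K = suc k
      s : St
      s = stateAfter k
      open Local s K public

      readSym≡ : cS ≡ readSym K
      readSym≡ with Zp K ≡ᵇ 0
      ... | true = cong bwt0 k0-eq
      ... | false = cong bwt1 k1-eq

      opens≡ : (not (B s K ≡ᵇ 0) ∧ not (B s K ≡ᵇ h)) ≡ opens K
      opens≡ with B-eq K
      ... | inj₁ e rewrite e = refl
      ... | inj₂ (e0 , e) rewrite e | e0 | eqb-refl h = ∧-zeroʳ _

      curId≡ : idS ≡ curId K
      curId≡ rewrite opens≡ | id-eq = refl

      fresh≡ : frS ≡ fresh K
      fresh≡ rewrite readSym≡ | curId≡ | blk-eq (readSym K) = refl

      dest≡ : jS ≡ dest K
      dest≡ rewrite readSym≡ with 1 <ᵇ readSym K in e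
      ... | true = trans (F-eq (readSym K)) (cong (F₀ (readSym K) +_) (cnt-ext _ _ k (λ j _ → cong (_∧ (readSym j ≡ᵇ readSym K)) e)))
      ... | false = refl

      k0-step : k0 s' ≡ suc (cnt isZero K)
      k0-step rewrite k0-eq = count-step (Zp K ≡ᵇ 0)
        where count-step : ∀ b → (if b then suc (suc (cnt isZero k)) else suc (cnt isZero k)) ≡ suc (cnt isZero k + (if b then 1 else 0))
              count-step true = cong suc (sym (+-comm (cnt isZero k) 1))
              count-step false = cong suc (sym (+-identityʳ _))

      k1-step : k1 s' ≡ suc (cnt isOne K)
      k1-step rewrite k1-eq = count-step (Zp K ≡ᵇ 0)
        where count-step : ∀ b → (if b then suc (cnt isOne k) else suc (suc (cnt isOne k))) ≡ suc (cnt isOne k + (if not b then 1 else 0))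
              count-step true = cong suc (sym (+-identityʳ _))
              count-step false = cong suc (sym (+-comm (cnt isOne k) 1))

      F-step : ∀ c → F s' c ≡ F₀ c + cnt (λ j → (1 <ᵇ c) ∧ (readSym j ≡ᵇ c)) K
      F-step c = counter-update cS readSym≡ (F-eq c) (F-eq cS)
        where
        P : ℕ → Bool
        P j = (1 <ᵇ c) ∧ (readSym j ≡ᵇ c)
        counter-update : ∀ c0 → c0 ≡ readSym K → F s c ≡ F₀ c + cnt P k → F s c0 ≡ F₀ c0 + cnt (λ j → (1 <ᵇ c0) ∧ (readSym j ≡ᵇ c0)) k →
          (if 1 <ᵇ c0 then upd (F s) c0 (suc (F s c0)) else F s) c ≡ F₀ c + (cnt P k + (if (1 <ᵇ c) ∧ (readSym K ≡ᵇ c) then 1 else 0))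
        counter-update .(readSym K) refl fc fk with 1 <ᵇ readSym K in e1 | c ≟ readSym K
        ... | true | yes refl rewrite upd-same (F s) (readSym K) (suc (F s (readSym K))) | fk | eqb-refl (readSym K) | e1 =
               trans (sym (+-suc (F₀ (readSym K)) _)) (cong (F₀ (readSym K) +_) (+-comm 1 _))
        ... | true | no ne rewrite upd-other (F s) (readSym K) (suc (F s (readSym K))) c ne | fc | eqb-false (λ q → ne (sym q)) | ∧-zeroʳ (1 <ᵇ c) = cong (F₀ c +_) (sym (+-identityʳ _))
        ... | false | yes refl rewrite fk | e1 = cong (F₀ (readSym K) +_) (sym (+-identityʳ _))
        ... | false | no ne rewrite fc | eqb-false (λ q → ne (sym q)) | ∧-zeroʳ (1 <ᵇ c) = cong (F₀ c +_) (sym (+-identityʳ _))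

      blk-step : ∀ c → blk s' c ≡ lastId K c
      blk-step c = blockid-update cS idS frS readSym≡ curId≡ refl (blk-eq c)
        where
        blockid-update : ∀ c0 id0 f → c0 ≡ readSym K → id0 ≡ curId K → f ≡ not (eqM (blk s c0) id0) → blk s c ≡ lastId k c →
          (if f then upd (blk s) c0 (just id0) else blk s) c ≡ (if readSym K ≡ᵇ c then just (curId K) else lastId k c)
        blockid-update .(readSym K) .(curId K) f refl refl ef ib with c ≟ readSym K
        ... | yes refl rewrite eqb-refl (readSym K) with f
        ...   | true = upd-same (blk s) (readSym K) (just (curId K))
        ...   | false = eqM-true _ _ (not-injective (sym ef))
        blockid-update .(readSym K) .(curId K) f refl refl ef ib | no ne rewrite eqb-false (λ q → ne (sym q)) with f
        ...   | true = trans (upd-other (blk s) (readSym K) (just (curId K)) c ne) ib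
        ...   | false = ib

      B-step : ∀ x → B s' x ≡ B₀ x ⊎ (B₀ x ≡ 0 × B s' x ≡ h)
      B-step x = B-update (frS ∧ (B s jS ≡ᵇ 0)) jS (λ e → eqb-true (∧-true-right e))
        where
        B-update : ∀ (g : Bool) j → (g ≡ true → B s j ≡ 0) →
          (if g then upd (B s) j h else B s) x ≡ B₀ x ⊎ (B₀ x ≡ 0 × (if g then upd (B s) j h else B s) x ≡ h)
        B-update false j _ = B-eq x
        B-update true j hz with x ≟ j
        ... | yes refl rewrite upd-same (B s) x h = inj₂ (b0 (B-eq x) , refl)
          where b0 : B s x ≡ B₀ x ⊎ (B₀ x ≡ 0 × B s x ≡ h) → B₀ x ≡ 0
                b0 (inj₁ e) = trans (sym e) (hz refl)
                b0 (inj₂ (e , _)) = e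
        ... | no ne rewrite upd-other (B s) j h x ne = B-eq x

      tracks-step : Tracks s' K
      tracks-step = record { k0-eq = k0-step ; k1-eq = k1-step ; F-eq = F-step ; id-eq = curId≡ ; blk-eq = blk-step ; B-eq = B-step }

    tracks : ∀ k → TracksAt k
    tracks zero = tracks-init
    tracks (suc k) = subst (λ q → Tracks q (suc k)) (sym (stateAfter-suc k)) (TrackStep.tracks-step k (tracks k))

    -- Distinct steps write distinct positions (proved later, for the
    -- actual inputs, from the LF-property).
    DestInjective : Set
    DestInjective = ∀ a b → In n a → In n b → dest a ≡ dest b → a ≡ b

    record Writes (q : St) (k : ℕ) : Set where
      field
        Z-at-dest : ∀ j' → 1 ≤ j' → j' ≤ k → Znew q (dest j') ≡ Zp j'
        B-at-dest : ∀ j' → 1 ≤ j' → j' ≤ k → B q (dest j') ≡ written j'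
        B-off-dest : ∀ x → (∀ j'' → 1 ≤ j'' → j'' ≤ k → ¬ dest j'' ≡ x) → B q x ≡ B₀ x

    module WriteStep (ji : DestInjective) (k : ℕ) (kn : suc k ≤ n) (J : Writes (stateAfter k) k) where
      open Writes J
      open TrackStep k (tracks k)

      earlier-dest-differs : ∀ j' → 1 ≤ j' → j' ≤ k → ¬ dest j' ≡ dest K
      earlier-dest-differs j' a b e = 1+n≰n (subst (_≤ k) (ji j' K (a , ≤-trans b (≤-trans (n≤1+n k) kn)) (s≤s z≤n , kn) e) b)

      Z-written : ∀ j' → 1 ≤ j' → j' ≤ K → Znew s' (dest j') ≡ Zp j'
      Z-written j' a b = Z-write jS dest≡
        where
        Z-write : ∀ j0 → j0 ≡ dest K → upd (Znew s) j0 (Zp K) (dest j') ≡ Zp j'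
        Z-write .(dest K) refl with m≤n⇒m<n∨m≡n b
        ... | inj₂ refl = upd-same (Znew s) (dest K) (Zp K)
        ... | inj₁ l = trans (upd-other (Znew s) (dest K) (Zp K) (dest j') (earlier-dest-differs j' a (≤-pred l))) (Z-at-dest j' a (≤-pred l))

      B-elsewhere : ∀ x → (x ≡ dest K → ⊥) → B s' x ≡ B s x
      B-elsewhere x ne = B-mark (frS ∧ (B s jS ≡ᵇ 0)) jS dest≡
        where
        B-mark : ∀ g j0 → j0 ≡ dest K → (if g then upd (B s) j0 h else B s) x ≡ B s x
        B-mark false j0 _ = refl
        B-mark true .(dest K) refl = upd-other (B s) (dest K) h x ne

      B-before : B s (dest K) ≡ B₀ (dest K)
      B-before = B-off-dest (dest K) (λ j'' a b e → earlier-dest-differs j'' a b e)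

      B-written : ∀ j' → 1 ≤ j' → j' ≤ K → B s' (dest j') ≡ written j'
      B-written j' a b with m≤n⇒m<n∨m≡n b
      ... | inj₁ l = trans (B-elsewhere (dest j') (earlier-dest-differs j' a (≤-pred l))) (B-at-dest j' a (≤-pred l))
      ... | inj₂ refl = B-mark-here frS jS fresh≡ dest≡
        where
        B-mark-here : ∀ f j0 → f ≡ fresh K → j0 ≡ dest K → (if f ∧ (B s j0 ≡ᵇ 0) then upd (B s) j0 h else B s) (dest K) ≡ written K
        B-mark-here .(fresh K) .(dest K) refl refl rewrite B-before with fresh K ∧ (B₀ (dest K) ≡ᵇ 0)
        ... | true = upd-same (B s) (dest K) h
        ... | false = B-before

      B-untouched : ∀ x → (∀ j'' → 1 ≤ j'' → j'' ≤ K → ¬ dest j'' ≡ x) → B s' x ≡ B₀ x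
      B-untouched x nh = trans (B-elsewhere x (λ e → nh K (s≤s z≤n) ≤-refl (sym e))) (B-off-dest x (λ j'' a b → nh j'' a (≤-trans b (n≤1+n k))))

      writes-step : Writes s' K
      writes-step = record { Z-at-dest = Z-written ; B-at-dest = B-written ; B-off-dest = B-untouched }

    writes : DestInjective → ∀ k → k ≤ n → Writes (stateAfter k) k
    writes ji zero _ = record { Z-at-dest = λ j' a b → ⊥-elim (1+n≰n (≤-trans a b)) ; B-at-dest = λ j' a b → ⊥-elim (1+n≰n (≤-trans a b)) ; B-off-dest = λ x _ → refl }
    writes ji (suc k) kn = subst (λ q → Writes q (suc k)) (sym (stateAfter-suc k)) (WriteStep.writes-step ji k kn (writes ji k (≤-trans (n≤1+n k) kn)))

    NoOpening : ℕ → ℕ → Set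
    NoOpening a b = ∀ i → a < i → i ≤ b → opens i ≡ false

    curId-le : ∀ k → curId k ≤ k
    curId-le zero = z≤n
    curId-le (suc k) with opens (suc k)
    ... | true = ≤-refl
    ... | false = ≤-trans (curId-le k) (n≤1+n k)

    curId-ge : ∀ k i → i ≤ k → opens i ≡ true → i ≤ curId k
    curId-ge zero i le b rewrite n≤0⇒n≡0 le = z≤n
    curId-ge (suc k) i le b with m≤n⇒m<n∨m≡n le
    ... | inj₂ refl rewrite b = ≤-refl
    ... | inj₁ l with opens (suc k)
    ...   | true = le
    ...   | false = curId-ge k i (≤-pred l) b

    curId-stable : ∀ a b → a ≤ b → NoOpening a b → curId b ≡ curId a
    curId-stable a zero le sb rewrite n≤0⇒n≡0 le = refl
    curId-stable a (suc b) le sb with m≤n⇒m<n∨m≡n le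
    ... | inj₂ refl = refl
    ... | inj₁ l rewrite sb (suc b) l ≤-refl = curId-stable a b (≤-pred l) (λ i ai ib → sb i ai (≤-trans ib (n≤1+n b)))

    curId-eq⇒NoOpening : ∀ a b → curId a ≡ curId b → NoOpening a b
    curId-eq⇒NoOpening a b e i ai ib with opens i in bi
    ... | false = refl
    ... | true = ⊥-elim (1+n≰n (≤-trans ai (≤-trans (curId-ge b i ib bi) (subst (_≤ a) e (curId-le a)))))

    data LastIdSpec (k c : ℕ) : Set where
      bnone : lastId k c ≡ nothing → (∀ j → 1 ≤ j → j ≤ k → ¬ readSym j ≡ c) → LastIdSpec k c
      bsome : ∀ j → 1 ≤ j → j ≤ k → readSym j ≡ c → (∀ j' → j < j' → j' ≤ k → ¬ readSym j' ≡ c) → lastId k c ≡ just (curId j) → LastIdSpec k c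

    lastId-spec : ∀ k c → LastIdSpec k c
    lastId-spec zero c = bnone refl (λ j a b → ⊥-elim (1+n≰n (≤-trans a b)))
    lastId-spec (suc k) c with readSym (suc k) ≟ c
    ... | yes e = bsome (suc k) (s≤s z≤n) ≤-refl e (λ j' l l' → ⊥-elim (1+n≰n (≤-trans l l'))) (trans (cong (λ u → if u ≡ᵇ c then just (curId (suc k)) else lastId k c) e) (cong (λ u → if u then just (curId (suc k)) else lastId k c) (eqb-refl c)))
    ... | no ne with lastId-spec k c
    ...   | bnone e h' = bnone (trans (cong (λ u → if u then just (curId (suc k)) else lastId k c) (eqb-false ne)) e)
               (λ j a b → case (m≤n⇒m<n∨m≡n b) a)
      where case : ∀ {j} → j < suc k ⊎ j ≡ suc k → 1 ≤ j → ¬ readSym j ≡ c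
            case (inj₁ l) a = h' _ a (≤-pred l)
            case (inj₂ refl) a = ne
    ...   | bsome j a b e h' be = bsome j a (≤-trans b (n≤1+n k)) e
               (λ j' l l' → case (m≤n⇒m<n∨m≡n l') l)
               (trans (cong (λ u → if u then just (curId (suc k)) else lastId k c) (eqb-false ne)) be)
      where case : ∀ {j'} → j' < suc k ⊎ j' ≡ suc k → j < j' → ¬ readSym j' ≡ c
            case (inj₁ l) l0 = h' _ l0 (≤-pred l)
            case (inj₂ refl) _ = ne

    fresh-false⇒ : ∀ k → fresh (suc k) ≡ false → Σ ℕ λ j → 1 ≤ j × j ≤ k × readSym j ≡ readSym (suc k) × NoOpening j (suc k)
    fresh-false⇒ k fe with lastId-spec k (readSym (suc k))
    ... | bnone e _ rewrite e = ⊥-elim (t≢f fe)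
    ... | bsome j a b e _ be rewrite be = j , a , b , e , curId-eq⇒NoOpening j (suc k) (eqb-true (not-injective fe))

    fresh-false⇐ : ∀ k j → 1 ≤ j → j ≤ k → readSym j ≡ readSym (suc k) → NoOpening j (suc k) → fresh (suc k) ≡ false
    fresh-false⇐ k j a b e sb with lastId-spec k (readSym (suc k))
    ... | bnone _ h' = ⊥-elim (h' j a b e)
    ... | bsome j' a' b' e' h' be rewrite be = cong not (subst (λ u → (curId j' ≡ᵇ u) ≡ true) (sym (curId-stable j' (suc k) (≤-trans b' (n≤1+n k)) sb')) (eqb-refl (curId j')))
      where
      j≤j' : j ≤ j'
      j≤j' = ≮⇒≥ (λ l → h' j l b e)
      sb' : NoOpening j' (suc k)
      sb' i l1 l2 = sb i (≤-<-trans j≤j' l1) l2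

module Invariant where

  open import Data.Nat using (ℕ; zero; suc; _+_; _∸_; _≤_; _<_; _<ᵇ_; _≡ᵇ_; z≤n; s≤s; _≟_; _≤?_)
  open import Data.Nat.Properties
  open import Data.Bool using (Bool; true; false; if_then_else_; _∧_; _∨_; not)
  open import Data.Bool.Properties using (∧-zeroʳ; ∧-identityʳ; ∨-identityʳ)
  open import Data.List using ([]; _∷_; take; _++_)
  open import Data.Product using (_×_; _,_; proj₁; proj₂)
  open import Data.Sum using (inj₁; inj₂)
  open import Data.Empty using (⊥-elim)
  open import Relation.Nullary using (Dec; yes; no)
  open import Relation.Binary.PropositionalEquality
  open import Defs
  open Booleans
  open Counting
  open Lex
  open OneText
  open TwoTexts
  open PrefixOrder
  open Concat
  open Iteration

  module Main (σ : ℕ) (t0 t1 : Str) (sa0 sa1 sa01 : ℕ → ℕ)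
    (hs0 : IsStr 0 σ t0) (hs1 : IsStr 1 σ t1) (ha0 : IsSA t0 sa0) (ha1 : IsSA t1 sa1)
    (ha01 : IsSA (t0 ++ t1) sa01) where

    open Suffixes01 σ t0 t1 sa0 sa1 sa01 hs0 hs1 ha0 ha1 ha01 public
    module P = Procedure (bwt t0 sa0) (bwt t1 sa1) n0 n1

    Bspec : ℕ → ℕ → ℕ
    Bspec h i = if i ≡ᵇ 1 then 1 else (if ℓ i <ᵇ h then suc (ℓ i) else 0)

    InvH : ℕ → Set
    InvH h = (∀ x → In n x → proj₁ (P.after h) (pos h x) ≡ col x) × (∀ i → In n i → proj₂ (P.after h) i ≡ Bspec h i)

    -- The 0-order is the index order, which is how Z^(0) and B are initialised.
    inv0H : InvH 0
    inv0H = Z-init , B-init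
      where
      pos0 : ∀ x → In n x → pos 0 x ≡ x
      pos0 x (a , b) = trans (cong suc (cnt-below x n (≤-trans b (n≤1+n n)))) (suc-∸1 x a)
      Z-init : ∀ x → In n x → proj₁ (P.after 0) (pos 0 x) ≡ col x
      Z-init x ix = trans (cong P.Zinit (pos0 x ix)) (by-text x ix)
        where
        by-text : ∀ x → In n x → P.Zinit x ≡ col x
        by-text x ix with view x ix
        ... | v0 x i rewrite col0 x (proj₂ i) | ltb-intro {x} {suc n0} (s≤s (proj₂ i)) = refl
        ... | v1 r i rewrite col1 r (proj₁ i) | ltb-false {n0 + r} {suc n0} (λ l → 1+n≰n (≤-trans (m<m+n n0 (proj₁ i)) (≤-pred l))) = refl
      B-init : ∀ i → In n i → proj₂ (P.after 0) i ≡ Bspec 0 i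
      B-init i (a , b) rewrite eqb-false {i} {suc n} (λ q → 1+n≰n (subst (_≤ n) q b)) with i ≡ᵇ 1
      ... | true = refl
      ... | false = refl

    module NextIteration (H : ℕ) (IH : InvH H) where
      h : ℕ
      h = suc H
      Zp B₀ : ℕ → ℕ
      Zp = proj₁ (P.after H)
      B₀ = proj₂ (P.after H)
      module Iter = OneIteration (bwt t0 sa0) (bwt t1 sa1) n0 n1 h Zp B₀

      IZ : ∀ x → In n x → Zp (pos H x) ≡ col x
      IZ = proj₁ IH
      IB : ∀ i → In n i → B₀ i ≡ Bspec H i
      IB = proj₂ IH

      -- Reading.  Step pos H x reads the bwt symbol of x: the counter of
      -- x's text counts the same-coloured entries before x in the H-order,
      -- i.e. those before x in the index order.

      cnt-pre : ∀ (R : ℕ → Bool) x → In n x → cnt R (pos H x ∸ 1) ≡ cnt (λ y → (pos H y <ᵇ pos H x) ∧ R (pos H y)) n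
      cnt-pre R x ix = trans (cnt-prefix R (pos H x ∸ 1) n (≤-trans (m∸n≤m (pos H x) 1) (proj₂ (pos-into H x ix))))
                             (sym (cnt-perm (λ j → (j <ᵇ pos H x) ∧ R j) (pos H) n (posPerm H)))

      counter-pos : ∀ (Q : ℕ → Bool) x → In n x → (∀ y → In n y → Q (col y) ≡ (col y ≡ᵇ col x)) →
        suc (cnt (λ j → Q (Zp j)) (pos H x ∸ 1)) ≡ rk x
      counter-pos Q x ix hq = trans (cong suc (trans (cnt-pre (λ j → Q (Zp j)) x ix) (cnt-ext _ _ n same-col-before))) (cnt-samecol x ix)
        where
        same-col-before : ∀ y → In n y → ((pos H y <ᵇ pos H x) ∧ Q (Zp (pos H y))) ≡ ((y <ᵇ x) ∧ (col y ≡ᵇ col x))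
        same-col-before y iy rewrite IZ y iy | hq y iy with col y ≟ col x
        ... | no ne rewrite eqb-false ne | ∧-zeroʳ (pos H y <ᵇ pos H x) | ∧-zeroʳ (y <ᵇ x) = refl
        ... | yes cc rewrite cc | eqb-refl (col x) | pos-lt-b H y x iy ix = cong (_∧ true) (ltH-samecol H y x iy ix cc)

      readSym-pos : ∀ x → In n x → Iter.readSym (pos H x) ≡ chr x
      readSym-pos x ix with view x ix
      ... | v0 x i rewrite IZ x ix | col0 x (proj₂ i) | chr0 x (proj₂ i) =
            cong (bwt t0 sa0) (trans (counter-pos (λ v → v ≡ᵇ 0) x ix (λ y _ → cong (col y ≡ᵇ_) (sym (col0 x (proj₂ i)))))
                                     (rk-lo x (proj₂ i)))
      ... | v1 r i rewrite IZ (n0 + r) ix | col1 r (proj₁ i) | chr1 r (proj₁ i) =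
            cong (bwt t1 sa1) (trans (counter-pos (λ v → not (v ≡ᵇ 0)) (n0 + r) ix
                                       (λ y _ → trans (col-not0 y) (cong (col y ≡ᵇ_) (sym (col1 r (proj₁ i))))))
                                     (rk-hi r (proj₁ i)))

      -- Step pos H x writes to position pos h (LFe x): the
      -- counter F[c] has passed the suffixes starting with a smaller
      -- symbol and the LF images of the earlier entries reading c.

      dest-big : ∀ x → In n x → 2 ≤ chr x → Iter.dest (pos H x) ≡ pos h (LFe x)
      dest-big x ix c2 rewrite readSym-pos x ix | ltb-intro {1} {chr x} c2 = begin
          suc (cntLess (bwt t0 sa0) c n0 + cntLess (bwt t1 sa1) c n1) + cnt (λ j → Iter.readSym j ≡ᵇ c) (pos H x ∸ 1)
        ≡⟨ cong₂ (λ u v → suc u + v) (sym (cnt-hd c)) (cnt-pre (λ j → Iter.readSym j ≡ᵇ c) x ix) ⟩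
          suc (cnt (λ z → hd (S z) <ᵇ c) n + cnt (λ y → (pos H y <ᵇ pos H x) ∧ (Iter.readSym (pos H y) ≡ᵇ c)) n)
        ≡⟨ cong (λ v → suc (cnt (λ z → hd (S z) <ᵇ c) n + v)) (cnt-ext _ _ n (λ y iy → trans
             (cong (λ u → (pos H y <ᵇ pos H x) ∧ (u ≡ᵇ c)) (readSym-pos y iy)) (sym (ltH-LF H x y ix iy c2)))) ⟩
          suc (cnt (λ z → hd (S z) <ᵇ c) n + cnt (λ y → (hd (S (LFe y)) ≡ᵇ c) ∧ ltH h (LFe y) (LFe x)) n)
        ≡⟨ cong (λ v → suc (cnt (λ z → hd (S z) <ᵇ c) n + v)) (cnt-perm (λ z → (hd (S z) ≡ᵇ c) ∧ ltH h z (LFe x)) LFe n LFePerm) ⟩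
          suc (cnt (λ z → hd (S z) <ᵇ c) n + cnt (λ z → (hd (S z) ≡ᵇ c) ∧ ltH h z (LFe x)) n)
        ≡⟨ cong suc (sym (cnt-or _ _ n (λ z _ → ∧-exclusive (hd (S z) <ᵇ c) (hd (S z) ≡ᵇ c) (ltH h z (LFe x)) (lt-eq-exclusive (hd (S z)) c)))) ⟩
          suc (cnt (λ z → (hd (S z) <ᵇ c) ∨ ((hd (S z) ≡ᵇ c) ∧ ltH h z (LFe x))) n)
        ≡⟨ cong suc (sym (cnt-ext _ _ n (λ z iz → ltH-split H x z ix iz c (chr-big x ix c2)))) ⟩
          pos h (LFe x) ∎
        where
        open ≡-Reasoning
        c : ℕ
        c = chr x

      -- For a terminator, the destination is 1 + col x: only the suffix $_0
      -- can precede the one-symbol suffix $_1.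
      dest-small : ∀ x → In n x → chr x ≡ col x → S (LFe x) ≡ col x ∷ [] → Iter.dest (pos H x) ≡ pos h (LFe x)
      dest-small x ix cx ex rewrite readSym-pos x ix | ltb-false {1} {chr x} (λ l → 1+n≰n (≤-trans l (subst (_≤ 1) (sym cx) (col≤1 x)))) | IZ x ix =
        cong suc (sym (trans (cnt-ext _ _ n before-terminator) (cnt-terminator-below (col x) (col≤1 x))))
        where
        before-terminator : ∀ z → In n z → ltH h z (LFe x) ≡ (hd (S z) <ᵇ col x)
        before-terminator z iz with S-cons z iz
        ... | d , r , ez rewrite hd-eq ez =
              trans (cons-split (pre h z) (pre h (LFe x)) d (col x) (take H r) (take H []) z (LFe x) (cong (take h) ez) (cong (take h) ex))
                (trans (cong ((d <ᵇ col x) ∨_) same-head-impossible) (∨-identityʳ (d <ᵇ col x)))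
          where
          same-head-impossible : ((d ≡ᵇ col x) ∧ ltH h z (LFe x)) ≡ false
          same-head-impossible with d ≟ col x
          ... | no ne rewrite eqb-false ne = refl
          ... | yes refl rewrite eqb-refl d = ltH-false h z (LFe x) λ p → LtH-irrefl h z (subst (LtH h z) (sym z≡LFx) p)
            where
            z≡LFx : z ≡ LFe x
            z≡LFx = S-inj z (LFe x) iz (LFe-into x ix) (trans ez (trans (cong (d ∷_) (ends-head≤1 (subst Ends ez (S-Ends z iz)) (col≤1 x))) (sym ex)))

      dest-pos : ∀ x → In n x → Iter.dest (pos H x) ≡ pos h (LFe x)
      dest-pos x ix with chr-cases x ix
      ... | inj₁ (c2 , _) = dest-big x ix c2
      ... | inj₂ (cx , ex) = dest-small x ix cx ex

      dest-injective : Iter.DestInjective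
      dest-injective a b ia ib e with surj (pos H) n (posPerm H) a ia | surj (pos H) n (posPerm H) b ib
      ... | x , ix , refl | y , iy , refl =
            cong (pos H) (LFe-inj x y ix iy (pos-inj h _ _ (LFe-into x ix) (LFe-into y iy) (trans (sym (dest-pos x ix)) (trans e (dest-pos y iy)))))

      -- Openings.  Step k+1 ≥ 2 resets id exactly at the boundaries of the
      -- H-order, so a stretch of steps without openings is a block.

      opens-Bspec : ∀ k' → 1 ≤ k' → suc k' ≤ n →
        Iter.opens (suc k') ≡ (not (Bspec H (suc k') ≡ᵇ 0) ∧ not (Bspec H (suc k') ≡ᵇ h))
      opens-Bspec k' a b = cong (λ v → not (v ≡ᵇ 0) ∧ not (v ≡ᵇ h)) (IB (suc k') (s≤s z≤n , b))

      opens⇒boundary : ∀ k' → 1 ≤ k' → suc k' ≤ n → Iter.opens (suc k') ≡ true → Bd H (suc k')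
      opens⇒boundary (suc k'') a b e with ℓ (suc (suc k'')) <ᵇ H in el
      ... | true = bd-lt H (suc k'') a b (ltb-true el)
      ... | false = ⊥-elim (t≢f (trans (sym e) (trans (opens-Bspec (suc k'') a b)
                      (cong (λ u → not ((if u then suc ℓk else 0) ≡ᵇ 0) ∧ not ((if u then suc ℓk else 0) ≡ᵇ h)) el))))
        where ℓk : ℕ
              ℓk = ℓ (suc (suc k''))

      boundary⇒opens : ∀ k' → 1 ≤ k' → suc k' ≤ n → Bd H (suc k') → Iter.opens (suc k') ≡ true
      boundary⇒opens (suc k'') a b bd with ℓ (suc (suc k'')) <ᵇ H in el
      ... | false = ⊥-elim (bd-ge H (suc k'') a b (ltb-false⇒ el) bd)
      ... | true = trans (opens-Bspec (suc k'') a b)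
                     (trans (cong (λ u → not ((if u then suc ℓk else 0) ≡ᵇ 0) ∧ not ((if u then suc ℓk else 0) ≡ᵇ h)) el)
                       (cong not (eqb-false {ℓk} {H} (λ q → <-irrefl q (ltb-true el)))))
        where ℓk : ℕ
              ℓk = ℓ (suc (suc k''))

      NoOpening⇒same : ∀ y x → In n y → In n x → pos H y < pos H x → Iter.NoOpening (pos H y) (pos H x) → pre H y ≡ pre H x
      NoOpening⇒same y x iy ix l none with eqL (pre H y) (pre H x) in e
      ... | true = eqL-sound _ _ e
      ... | false with diff-bd H y x iy ix l (eqL-false⇒ _ _ e)
      ...   | suc k' , l1 , l2 , bd =
              ⊥-elim (t≢f (trans (sym (boundary⇒opens k' (≤-pred (≤-trans (s≤s (s≤s z≤n)) l1)) (≤-trans l2 (proj₂ (pos-into H x ix))) bd)) (none (suc k') l1 l2)))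

      same⇒NoOpening : ∀ y x → In n y → In n x → pre H y ≡ pre H x → Iter.NoOpening (pos H y) (pos H x)
      same⇒NoOpening y x iy ix eq (suc k') l1 l2 = b≡f (λ bt → same-nobd H y x iy ix eq (suc k') l1 l2
         (opens⇒boundary k' (≤-pred (≤-trans (s≤s (s≤s z≤n)) l1)) (≤-trans l2 (proj₂ (pos-into H x ix))) bt))

      -- Step pos H x is fresh iff LFe x is the first element of
      -- its block in the h-order: an earlier element LFe y of the same
      -- block is preceded by the same symbol, and y lies in x's H-block.

      fresh-false : ∀ x → In n x → 1 ≤ D h (LFe x) → Iter.fresh (pos H x) ≡ false
      fresh-false x ix d1 with cnt-witness _ n d1
      ... | z , iz , ez with surj LFe n LFePerm z iz
      ...   | y , iy , refl = by-symbol (2 ≤? chr x)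
        where
        same-pre : pre h (LFe y) ≡ pre h (LFe x)
        same-pre = eqL-sound _ _ (∧-true-left ez)
        LFy<LFx : LFe y < LFe x
        LFy<LFx = ltb-true (∧-true-right ez)
        same-chr : chr y ≡ chr x
        same-chr = LF-pre-chr H x y ix iy same-pre
        by-symbol : Dec (2 ≤ chr x) → Iter.fresh (pos H x) ≡ false
        by-symbol (no small) = ⊥-elim (<-irrefl (cong LFe (small-uniq x y ix iy same-chr small)) LFy<LFx)
        by-symbol (yes c2) =
          Iter.fresh-false⇐ (pos H x ∸ 1) (pos H y) (s≤s z≤n) (≤-pred earlier)
            (trans (readSym-pos y iy) (trans same-chr (sym (readSym-pos x ix))))
            (same⇒NoOpening y x iy ix pre-H)
          where
          pre-H : pre H y ≡ pre H x
          pre-H = LF-pre⇒ H x y ix iy same-chr c2 same-pre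
          y<x : y < x
          y<x = ltb-true (trans (sym (LF-order x y ix iy same-chr c2)) (ltb-intro LFy<LFx))
          earlier : pos H y < pos H x
          earlier = pos-lt H y x iy ix (inj₂ (pre-H , y<x))

      fresh-true : ∀ x → In n x → D h (LFe x) ≡ 0 → Iter.fresh (pos H x) ≡ true
      fresh-true x ix d0 with Iter.fresh (pos H x) in ef
      ... | true = refl
      ... | false with Iter.fresh-false⇒ (pos H x ∸ 1) ef
      ...   | j , j1 , jk , ec , none with surj (pos H) n (posPerm H) j (j1 , ≤-trans jk (≤-trans (n≤1+n _) (proj₂ (pos-into H x ix))))
      ...     | y , iy , refl = by-symbol (2 ≤? chr x)
        where
        same-chr : chr y ≡ chr x
        same-chr = trans (sym (readSym-pos y iy)) (trans ec (readSym-pos x ix))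
        earlier : pos H y < pos H x
        earlier = s≤s jk
        by-symbol : Dec (2 ≤ chr x) → false ≡ true
        by-symbol (no small) = ⊥-elim (<-irrefl (cong (pos H) (small-uniq x y ix iy same-chr small)) earlier)
        by-symbol (yes c2) = ⊥-elim (1+n≰n (subst (1 ≤_) d0 (cnt-pos _ n (LFe y) (LFe-into y iy) LFy-before)))
          where
          pre-H : pre H y ≡ pre H x
          pre-H = NoOpening⇒same y x iy ix earlier none
          LFy-before : (eqL (pre h (LFe y)) (pre h (LFe x)) ∧ (LFe y <ᵇ LFe x)) ≡ true
          LFy-before rewrite LF-pre⇐ H x y ix iy same-chr c2 pre-H | eqL-refl (pre h (LFe x)) =
            trans (LF-order x y ix iy same-chr c2) (ltb-intro (pos-lt-same H y x iy ix pre-H earlier))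

      B-update : ∀ i → In n i → (fr : Bool) → (fr ≡ true → Bd h i) → (Bd h i → fr ≡ true) →
        (if fr ∧ (Bspec H i ≡ᵇ 0) then h else Bspec H i) ≡ Bspec h i
      B-update (suc zero) _ fr _ _ rewrite ∧-zeroʳ fr = refl
      B-update (suc (suc k')) (_ , b) fr fresh⇒bd bd⇒fresh with ℓ (suc (suc k')) <ᵇ H in el
      ... | true rewrite ∧-zeroʳ fr | ltb-intro {ℓ (suc (suc k'))} {suc H} (≤-trans (ltb-true el) (n≤1+n H)) = refl
      ... | false rewrite ∧-identityʳ fr with ℓ (suc (suc k')) ≟ H
      ...   | yes eq rewrite bd⇒fresh (bd-lt h (suc k') (s≤s z≤n) b (subst (_< h) (sym eq) ≤-refl))
                           | ltb-intro {ℓ (suc (suc k'))} {suc H} (subst (_< h) (sym eq) ≤-refl) = cong suc (sym eq)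
      ...   | no ne rewrite ltb-false {ℓ (suc (suc k'))} {suc H} (λ l → ne (≤-antisym (≤-pred l) (ltb-false⇒ el))) with fr in ef
      ...     | true = ⊥-elim (bd-ge h (suc k') (s≤s z≤n) b (≤∧≢⇒< (ltb-false⇒ el) (λ q → ne (sym q))) (fresh⇒bd refl))
      ...     | false = refl

      -- Every position is pos h (LFe x) for exactly one x, written at step
      -- pos H x; hence the invariant holds after iteration h.
      nextH : InvH h
      nextH = Z-next , B-next
        where
        open Iter.Writes (Iter.writes dest-injective n ≤-refl)
        Z-next : ∀ z → In n z → Znew (Iter.stateAfter n) (pos h z) ≡ col z
        Z-next z iz with surj LFe n LFePerm z iz
        ... | x , ix , refl = trans (cong (Znew (Iter.stateAfter n)) (sym (dest-pos x ix)))
            (trans (Z-at-dest (pos H x) (s≤s z≤n) (proj₂ (pos-into H x ix))) (trans (IZ x ix) (sym (LFe-col x ix))))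
        B-next : ∀ i → In n i → B (Iter.stateAfter n) i ≡ Bspec h i
        B-next i ii with surj (pos h) n (posPerm h) i ii
        ... | z , iz , refl with surj LFe n LFePerm z iz
        ...   | x , ix , refl =
            trans (cong (B (Iter.stateAfter n)) (sym (dest-pos x ix)))
              (trans (B-at-dest (pos H x) (s≤s z≤n) (proj₂ (pos-into H x ix)))
                (trans (cong (λ j → if Iter.fresh (pos H x) ∧ (B₀ j ≡ᵇ 0) then h else B₀ j) (dest-pos x ix))
                  (trans (cong (λ v → if Iter.fresh (pos H x) ∧ (v ≡ᵇ 0) then h else v) (IB _ (pos-into h (LFe x) (LFe-into x ix))))
                    (B-update (pos h (LFe x)) (pos-into h (LFe x) (LFe-into x ix)) (Iter.fresh (pos H x)) fresh⇒bd bd⇒fresh))))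
          where
          fresh⇒bd : Iter.fresh (pos H x) ≡ true → Bd h (pos h (LFe x))
          fresh⇒bd e with D h (LFe x) ≟ 0
          ... | yes d0 = first-bd h (LFe x) (LFe-into x ix) d0
          ... | no d1 = ⊥-elim (t≢f (trans (sym e) (fresh-false x ix (≤∧≢⇒< z≤n (λ q → d1 (sym q))))))
          bd⇒fresh : Bd h (pos h (LFe x)) → Iter.fresh (pos H x) ≡ true
          bd⇒fresh bd with D h (LFe x) ≟ 0
          ... | yes d0 = fresh-true x ix d0
          ... | no d1 = ⊥-elim (notfirst h (LFe x) (LFe-into x ix) (≤∧≢⇒< z≤n (λ q → d1 (sym q))) bd)

    invH : ∀ h → InvH h
    invH zero = inv0H
    invH (suc H) = NextIteration.nextH H (invH H)

    B-final : ∀ i → 2 ≤ i → i ≤ n → ∀ g → ℓ i + 1 ≤ g → proj₂ (P.after g) i ≡ ℓ i + 1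
    B-final (suc zero) (s≤s ()) b g lg
    B-final (suc (suc k)) _ b g lg
      rewrite proj₂ (invH g) (suc (suc k)) (s≤s z≤n , b) | ltb-intro {ℓ (suc (suc k))} {g} (subst (_≤ g) (+-comm (ℓ (suc (suc k))) 1) lg) =
      +-comm 1 _

corollary1 : (σ : ℕ) (t0 t1 : Str) (sa0 sa1 sa01 : ℕ → ℕ) →
    IsStr 0 σ t0 → IsStr 1 σ t1 →
    IsSA t0 sa0 → IsSA t1 sa1 → IsSA (t0 ++ t1) sa01 →
    (i : ℕ) → 2 ≤ i → i ≤ length t0 + length t1 →
    (ℓ : ℕ) → lcp01 t0 t1 sa01 i ≡ ℓ →
    (g : ℕ) → ℓ + 1 ≤ g →
    Bat t0 t1 sa0 sa1 g i ≡ ℓ + 1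
corollary1 σ t0 t1 sa0 sa1 sa01 hs0 hs1 ha0 ha1 ha01 i 2≤i i≤n ℓ refl g ℓ<g =
  Invariant.Main.B-final σ t0 t1 sa0 sa1 sa01 hs0 hs1 ha0 ha1 ha01 i 2≤i i≤n g ℓ<g
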